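{- Let $R$ be an Eulerian poset and let $\sigma_1:(\Gamma^1,\Gamma_B)\to R^\pm$ and $\sigma_2:(\Gamma^2,\Gamma_B)\to R^\pm$ be strong formal subdivisions with boundary sharing the same boundary $\sigma_B:\Gamma_B\to R^-$ (with $\Gamma_B=\Gamma^1\cap\Gamma^2$). Then the local $h$-polynomial of their agglutination $\sigma_1\sharp_{\sigma_B}\sigma_2:\Gamma^1\sharp_{\Gamma_B}\Gamma^2\to R$ satisfies $$\ell_R(\Gamma^1\sharp_{\Gamma_B}\Gamma^2;t)=\ell_{R^\pm}(\Gamma^1;t)+\ell_{R^\pm}(\Gamma^2;t)+(t+1)\,\ell_{R^- }(\Gamma_B;t).$$
   Context: Posets: ranked, locally Eulerian, lower Eulerian (with minimum $\hat0$), Eulerian (also maximum $\hat1$) as usual; $\rho(x,y)=\rho(y)-\rho(x)$; rank of a poset is the length of its longest chain; $B^*$ is the dual poset. For an Eulerian poset $B$ of rank $r$, $g(B;t)=1$ if $r=0$, otherwise the unique polynomial of degree $<r/2$ with $t^rg(B;t^{ -1})=\sum_{x\in B}g([\hat0,x];t)(t-1)^{r-\rho(\hat0,x)}$; for lower Eulerian $\Gamma$ of rank $r$, $t^rh(\Gamma;t^{ -1})=\sum_{x\in\Gamma}g([\hat0,x];t)(t-1)^{r-\rho(\hat0,x)}$. Strong formal subdivision: an order-preserving map $\sigma:\Gamma\to B$ between locally Eulerian posets which is rank-increasing ($\rho_\Gamma(y)\le\rho_B(\sigma(y))$), surjective, such that for all $y\in\Gamma$, $x\in B$ with $\sigma(y)\le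 x$ there is $y'\ge y$ with $\sigma(y')=x$, $\rho_\Gamma(y')=\rho_B(x)$, and $\sum_{y'\ge y,\ \sigma(y')=x}(-1)^{\rho_B(x)-\rho_\Gamma(y')}=1$. For $\Gamma$ lower Eulerian and $B$ Eulerian, with $\Gamma_x=\{y\in\Gamma:\sigma(y)\le x\}$, the local $h$-polynomial is $\ell_B(\Gamma;t)=\sum_{x\in B}h(\Gamma_x;t)(-1)^{\rho_B(x,\hat1_B)}g([x,\hat1_B]^*;t)$. Posets with boundary: $(\Gamma,\Gamma_B)$ with $\Gamma_B$ a lower set of $\Gamma$ and $\mathrm{rk}\Gamma_B=\mathrm{rk}\Gamma-1$. Twins-poset $R^\pm$: $R\sqcup R^-$ with $R^-$ a copy of $R$ via bijections $\phi^-:R\to R^-$, $\phi^+=(\phi^-)^{ -1}$, order generated by those of $R$, $R^-$ and $\phi^-(r)<r$. A strong formal subdivision with boundary is a map $\sigma:(\Gamma,\Gamma_B)\to R^\pm$ from a lower Eulerian poset with boundary to the twins-poset of an Eulerian poset $R$, with $\sigma(\Gamma\setminus\Gamma_B)=R$, $\sigma(\Gamma_B)=R^-$, such that both $\sigma$ and its restriction $\sigma_B:\Gamma_B\to R^-$ are strong formal subdivisions. The agglutination $\Gamma^1\sharp_{\Gamma_B}\Gamma^2$ is the poset on $\Gamma^1\cup\Gamma^2$ inducing the given orders on each $\Gamma^i$ with $\Gamma^1\setminus\Gamma_B$ and $\Gamma^2\setminus\Gamma_B$ incomparable; the agglutination map $\sigma_1\sharp_{\sigma_B}\sigma_2$ equals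 $\phi^+\circ\sigma_B$ on $\Gamma_B$, $\sigma_1$ on $\Gamma^1\setminus\Gamma_B$ and $\sigma_2$ on $\Gamma^2\setminus\Gamma_B$ (it is a strong formal subdivision onto $R$). -}

module Defs where

open import Data.Nat as ℕ using (ℕ; zero; suc; _∸_; _⊔_; _<ᵇ_; _≤ᵇ_)
open import Data.Integer as ℤ using (ℤ; +_; -_)
open import Data.Bool using (Bool; true; false; _∧_; not; if_then_else_; T)
open import Data.List using (List; []; _∷_; map; _++_; mapMaybe; length)
open import Data.List.Membership.Propositional using (_∈_)
open import Data.List.Relation.Unary.Unique.Propositional using (Unique)
open import Data.Sum using (_⊎_; inj₁; inj₂; [_,_])
open import Data.Sum.Properties using (≡-dec; inj₁-injective; inj₂-injective)
open import Data.Product using (_×_; _,_; ∃-syntax)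
open import Data.Maybe using (Maybe; just; nothing)
open import Data.Empty using (⊥)
open import Function using (id; flip; _∘_)
open import Relation.Nullary using (Dec; yes; no; does; ¬_)
open import Relation.Nullary.Decidable using (map′)
open import Relation.Binary using (Decidable; DecidableEquality; IsPartialOrder)
open import Relation.Binary.PropositionalEquality using (_≡_; _≢_; cong)

-- Integer polynomials, represented by their coefficient sequences
-- (p k = coefficient of t^k).  Equality of polynomials = pointwise.

Poly : Set
Poly = ℕ → ℤ

sumUpTo : (ℕ → ℤ) → ℕ → ℤ
sumUpTo f zero = f zero
sumUpTo f (suc n) = sumUpTo f n ℤ.+ f (suc n)

0P : Poly
0P _ = + 0

1P : Poly
1P zero = + 1
1P (suc _) = + 0

tm1P : Poly
tm1P zero = - (+ 1)
tm1P (suc zero) = + 1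
tm1P (suc (suc _)) = + 0

tp1P : Poly
tp1P zero = + 1
tp1P (suc zero) = + 1
tp1P (suc (suc _)) = + 0

infixl 6 _⊕_
infixl 7 _⊛_ _•_

_⊕_ : Poly → Poly → Poly
(p ⊕ q) k = p k ℤ.+ q k

_⊛_ : Poly → Poly → Poly
(p ⊛ q) k = sumUpTo (λ i → p i ℤ.* q (k ∸ i)) k

_•_ : ℤ → Poly → Poly
(c • p) k = c ℤ.* p k

negP : Poly → Poly
negP p k = - p k

powP : Poly → ℕ → Poly
powP p zero = 1P
powP p (suc n) = p ⊛ powP p n

truncP : ℕ → Poly → Poly
truncP d p k = if (k ℕ.* 2) <ᵇ d then p k else + 0

-- t^r p(t^{-1}) for a polynomial p of degree ≤ r
revP : ℕ → Poly → Poly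
revP r p k = if k ≤ᵇ r then p (r ∸ k) else + 0

sgn : ℕ → ℤ
sgn zero = + 1
sgn (suc n) = - sgn n

ΣL : {A : Set} → (A → Bool) → List A → (A → Poly) → Poly
ΣL P [] f = 0P
ΣL P (x ∷ xs) f = if P x then f x ⊕ ΣL P xs f else ΣL P xs f

ΣZ : {A : Set} → (A → Bool) → List A → (A → ℤ) → ℤ
ΣZ P [] f = + 0
ΣZ P (x ∷ xs) f = if P x then f x ℤ.+ ΣZ P xs f else ΣZ P xs f

maxL : {A : Set} → (A → Bool) → List A → (A → ℕ) → ℕ
maxL P [] f = 0
maxL P (x ∷ xs) f = if P x then f x ⊔ maxL P xs f else maxL P xs f

-- With d = ρ(a,b) > 0 the defining identity
--   t^d g(t^{-1}) = Σ_{a ≤ z ≤ b} g([a,z];t)(t-1)^{d-ρ(a,z)}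
-- together with deg g < d/2 says exactly (looking at degrees < d/2) that
--   g = - (Σ_{a ≤ z < b} g([a,z];t)(t-1)^{d-ρ(a,z)})_{deg < d/2},
-- which is the recursion used here.  The natural-number argument is fuel
-- (the number of elements of the poset suffices).

gGen : {C : Set} → List C → DecidableEquality C → (C → C → Bool) →
       (C → C → ℕ) → ℕ → C → C → Poly
gStep : {C : Set} → List C → DecidableEquality C → (C → C → Bool) →
        (C → C → ℕ) → ℕ → C → C → ℕ → Poly

gGen es eq le δ zero a b = 1P
gGen es eq le δ (suc f) a b = gStep es eq le δ f a b (δ a b)

gStep es eq le δ f a b zero = 1P
gStep es eq le δ f a b (suc d) =
  negP (truncP (suc d)
    (ΣL (λ z → le a z ∧ le z b ∧ not (does (eq z b))) es
        (λ z → gGen es eq le δ f a z ⊛ powP tm1P (suc d ∸ δ a z))))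

record FinPoset (C : Set) : Set₁ where
  field
    enum : List C
    _≟_  : DecidableEquality C
    _≤_  : C → C → Set
    _≤?_ : Decidable _≤_
    ρ    : C → ℕ

  leB : C → C → Bool
  leB x y = does (x ≤? y)

  δ : C → C → ℕ
  δ x y = ρ y ∸ ρ x

  gI : C → C → Poly
  gI a b = gGen enum _≟_ leB δ (length enum) a b

  -- g([x,top]^*;t)  (dual poset: reversed order, reversed ranks)
  gDual : C → C → Poly
  gDual x top = gGen enum _≟_ (flip leB) (flip δ) (length enum) top x

  rankOf : (C → Bool) → C → ℕ
  rankOf P z = maxL P enum (δ z)

  -- h-polynomial of the lower Eulerian subposet P (with minimum z):
  -- t^r h(P;t^{-1}) = Σ_{y ∈ P} g([z,y];t)(t-1)^{r-ρ(z,y)}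
  hPoly : (C → Bool) → C → Poly
  hPoly P z = revP (rankOf P z)
    (ΣL P enum (λ y → gI z y ⊛ powP tm1P (rankOf P z ∸ δ z y)))

  Covers : C → C → Set
  Covers x y = x ≤ y × x ≢ y × (∀ w → x ≤ w → w ≤ y → w ≡ x ⊎ w ≡ y)

  IsFinite : Set
  IsFinite = (∀ x → x ∈ enum) × Unique enum

  Ranked : Set
  Ranked = ∀ x y → Covers x y → ρ y ≡ suc (ρ x)

  IntervalsEulerian : Set
  IntervalsEulerian = ∀ x y → x ≤ y → x ≢ y →
    ΣZ (λ w → leB x w ∧ leB w y) enum (λ w → sgn (ρ w)) ≡ + 0

  LocallyEulerian : Set
  LocallyEulerian = IsPartialOrder _≡_ _≤_ × Ranked × IntervalsEulerian

  LowerEulerian : C → Set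
  LowerEulerian z = LocallyEulerian × (∀ x → z ≤ x) × ρ z ≡ 0

  Eulerian : C → C → Set
  Eulerian z t = LowerEulerian z × (∀ x → x ≤ t)

open FinPoset public using (IsFinite; LowerEulerian; Eulerian)

-- Strong formal subdivision σ : S → B, where the domain is the subposet
-- of Γ given by the Boolean predicate S (with induced order and ranks).

record IsSFS {D E : Set} (Γ : FinPoset D) (S : D → Bool) (B : FinPoset E)
             (σ : D → E) : Set where
  field
    orderPreserving : ∀ y y' → T (S y) → T (S y') →
      FinPoset._≤_ Γ y y' → FinPoset._≤_ B (σ y) (σ y')
    rankIncreasing : ∀ y → T (S y) → FinPoset.ρ Γ y ℕ.≤ FinPoset.ρ B (σ y)
    surjective : ∀ x → ∃[ y ] (T (S y) × σ y ≡ x)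
    lifting : ∀ y x → T (S y) → FinPoset._≤_ B (σ y) x →
      ∃[ y' ] (T (S y') × FinPoset._≤_ Γ y y' × σ y' ≡ x ×
               FinPoset.ρ Γ y' ≡ FinPoset.ρ B x)
    eulerSum : ∀ y x → T (S y) → FinPoset._≤_ B (σ y) x →
      ΣZ (λ y' → S y' ∧ FinPoset.leB Γ y y' ∧ does (FinPoset._≟_ B (σ y') x))
         (FinPoset.enum Γ)
         (λ y' → sgn (FinPoset.ρ B x ∸ FinPoset.ρ Γ y')) ≡ + 1

ℓ : {D E : Set} (Γ : FinPoset D) (S : D → Bool) (z : D)
    (B : FinPoset E) (top : E) (σ : D → E) → Poly
ℓ Γ S z B top σ =
  ΣL (λ _ → true) (FinPoset.enum B)
    (λ x → FinPoset.hPoly Γ (λ y → S y ∧ FinPoset.leB B (σ y) x) z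
           ⊛ (sgn (FinPoset.δ B x top) • FinPoset.gDual B x top))

allP : {A : Set} → A → Bool
allP _ = true

-- Twins poset R^± on C ⊎ C : inj₁ r = φ⁻(r) ∈ R^-, inj₂ r = r ∈ R.
-- The order generated by those of R, R^- and φ⁻(r) < r is:
--   r⁻ ≤ s⁻ ⇔ r ≤ s,  r⁻ ≤ s ⇔ r ≤ s,  r ≤ s ⇔ r ≤ s,  never r ≤ s⁻.
-- Ranks: ρ(r⁻) = ρ_R(r), ρ(r) = ρ_R(r) + 1 (so the minimum 0̂⁻ has rank 0).

isMinus : {A B : Set} → A ⊎ B → Bool
isMinus (inj₁ _) = true
isMinus (inj₂ _) = false

isPlus : {A B : Set} → A ⊎ B → Bool
isPlus x = not (isMinus x)

φ⁺ : {C : Set} → C ⊎ C → C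
φ⁺ = [ id , id ]

twLe : {C : Set} → (C → C → Set) → C ⊎ C → C ⊎ C → Set
twLe le (inj₁ a) (inj₁ b) = le a b
twLe le (inj₁ a) (inj₂ b) = le a b
twLe le (inj₂ a) (inj₁ b) = ⊥
twLe le (inj₂ a) (inj₂ b) = le a b

twLe? : {C : Set} (le : C → C → Set) → Decidable le → Decidable (twLe le)
twLe? le d (inj₁ a) (inj₁ b) = d a b
twLe? le d (inj₁ a) (inj₂ b) = d a b
twLe? le d (inj₂ a) (inj₁ b) = no (λ ())
twLe? le d (inj₂ a) (inj₂ b) = d a b

twρ : {C : Set} → (C → ℕ) → C ⊎ C → ℕ
twρ ρ (inj₁ a) = ρ a
twρ ρ (inj₂ a) = suc (ρ a)

Twins : {C : Set} → FinPoset C → FinPoset (C ⊎ C)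
Twins R = record
  { enum = map inj₁ (FinPoset.enum R) ++ map inj₂ (FinPoset.enum R)
  ; _≟_  = ≡-dec (FinPoset._≟_ R) (FinPoset._≟_ R)
  ; _≤_  = twLe (FinPoset._≤_ R)
  ; _≤?_ = twLe? (FinPoset._≤_ R) (FinPoset._≤?_ R)
  ; ρ    = twρ (FinPoset.ρ R)
  }

-- Posets with boundary: Γ on CB ⊎ CI with boundary Γ_B = inj₁-part.

module _ {CB CI : Set} (Γ : FinPoset (CB ⊎ CI)) where
  open FinPoset Γ

  -- Γ_B is a lower set and rk Γ_B = rk Γ - 1 (rank = max of ρ, ρ(0̂) = 0)
  IsPosetWithBoundary : Set
  IsPosetWithBoundary =
    (∀ c b → ¬ (inj₂ c ≤ inj₁ b)) ×
    suc (maxL isMinus enum ρ) ≡ maxL allP enum ρ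

AgreeOnBoundary : {CB C1 C2 : Set} → FinPoset (CB ⊎ C1) → FinPoset (CB ⊎ C2) → Set
AgreeOnBoundary {CB} Γ1 Γ2 =
  (∀ (a b : CB) → (FinPoset._≤_ Γ1 (inj₁ a) (inj₁ b) → FinPoset._≤_ Γ2 (inj₁ a) (inj₁ b))
                × (FinPoset._≤_ Γ2 (inj₁ a) (inj₁ b) → FinPoset._≤_ Γ1 (inj₁ a) (inj₁ b))) ×
  (∀ (a : CB) → FinPoset.ρ Γ1 (inj₁ a) ≡ FinPoset.ρ Γ2 (inj₁ a))

MapsBoundary : {CB CI C : Set} → (CB ⊎ CI → C ⊎ C) → Set
MapsBoundary σ = (∀ b → T (isMinus (σ (inj₁ b)))) × (∀ c → T (isPlus (σ (inj₂ c))))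

module _ {CB C1 C2 : Set} (L1 : CB ⊎ C1 → CB ⊎ C1 → Set)
         (L2 : CB ⊎ C2 → CB ⊎ C2 → Set) where
  aggLe : CB ⊎ (C1 ⊎ C2) → CB ⊎ (C1 ⊎ C2) → Set
  aggLe (inj₁ a) (inj₁ b) = L1 (inj₁ a) (inj₁ b)
  aggLe (inj₁ a) (inj₂ (inj₁ c)) = L1 (inj₁ a) (inj₂ c)
  aggLe (inj₁ a) (inj₂ (inj₂ c)) = L2 (inj₁ a) (inj₂ c)
  aggLe (inj₂ (inj₁ c)) (inj₁ b) = L1 (inj₂ c) (inj₁ b)
  aggLe (inj₂ (inj₁ c)) (inj₂ (inj₁ d)) = L1 (inj₂ c) (inj₂ d)
  aggLe (inj₂ (inj₁ c)) (inj₂ (inj₂ d)) = ⊥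
  aggLe (inj₂ (inj₂ c)) (inj₁ b) = L2 (inj₂ c) (inj₁ b)
  aggLe (inj₂ (inj₂ c)) (inj₂ (inj₁ d)) = ⊥
  aggLe (inj₂ (inj₂ c)) (inj₂ (inj₂ d)) = L2 (inj₂ c) (inj₂ d)

  aggLe? : Decidable L1 → Decidable L2 → Decidable aggLe
  aggLe? d1 d2 (inj₁ a) (inj₁ b) = d1 (inj₁ a) (inj₁ b)
  aggLe? d1 d2 (inj₁ a) (inj₂ (inj₁ c)) = d1 (inj₁ a) (inj₂ c)
  aggLe? d1 d2 (inj₁ a) (inj₂ (inj₂ c)) = d2 (inj₁ a) (inj₂ c)
  aggLe? d1 d2 (inj₂ (inj₁ c)) (inj₁ b) = d1 (inj₂ c) (inj₁ b)
  aggLe? d1 d2 (inj₂ (inj₁ c)) (inj₂ (inj₁ d)) = d1 (inj₂ c) (inj₂ d)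
  aggLe? d1 d2 (inj₂ (inj₁ c)) (inj₂ (inj₂ d)) = no (λ ())
  aggLe? d1 d2 (inj₂ (inj₂ c)) (inj₁ b) = d2 (inj₂ c) (inj₁ b)
  aggLe? d1 d2 (inj₂ (inj₂ c)) (inj₂ (inj₁ d)) = no (λ ())
  aggLe? d1 d2 (inj₂ (inj₂ c)) (inj₂ (inj₂ d)) = d2 (inj₂ c) (inj₂ d)

aggρ : {CB C1 C2 : Set} → (CB ⊎ C1 → ℕ) → (CB ⊎ C2 → ℕ) → CB ⊎ (C1 ⊎ C2) → ℕ
aggρ r1 r2 (inj₁ b) = r1 (inj₁ b)
aggρ r1 r2 (inj₂ (inj₁ c)) = r1 (inj₂ c)
aggρ r1 r2 (inj₂ (inj₂ c)) = r2 (inj₂ c)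

emb1 : {CB C1 C2 : Set} → CB ⊎ C1 → CB ⊎ (C1 ⊎ C2)
emb1 (inj₁ b) = inj₁ b
emb1 (inj₂ c) = inj₂ (inj₁ c)

int2 : {CB C1 C2 : Set} → CB ⊎ C2 → Maybe (CB ⊎ (C1 ⊎ C2))
int2 (inj₁ _) = nothing
int2 (inj₂ c) = just (inj₂ (inj₂ c))

decL : {A B : Set} → DecidableEquality (A ⊎ B) → DecidableEquality A
decL d a b = map′ inj₁-injective (cong inj₁) (d (inj₁ a) (inj₁ b))

decR : {A B : Set} → DecidableEquality (A ⊎ B) → DecidableEquality B
decR d a b = map′ inj₂-injective (cong inj₂) (d (inj₂ a) (inj₂ b))

Agg : {CB C1 C2 : Set} → FinPoset (CB ⊎ C1) → FinPoset (CB ⊎ C2) →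
      FinPoset (CB ⊎ (C1 ⊎ C2))
Agg Γ1 Γ2 = record
  { enum = map emb1 (FinPoset.enum Γ1) ++ mapMaybe int2 (FinPoset.enum Γ2)
  ; _≟_  = ≡-dec (decL (FinPoset._≟_ Γ1))
                 (≡-dec (decR (FinPoset._≟_ Γ1)) (decR (FinPoset._≟_ Γ2)))
  ; _≤_  = aggLe (FinPoset._≤_ Γ1) (FinPoset._≤_ Γ2)
  ; _≤?_ = aggLe? (FinPoset._≤_ Γ1) (FinPoset._≤_ Γ2) (FinPoset._≤?_ Γ1) (FinPoset._≤?_ Γ2)
  ; ρ    = aggρ (FinPoset.ρ Γ1) (FinPoset.ρ Γ2)
  }

aggMap : {CB C1 C2 C : Set} → (CB ⊎ C1 → C ⊎ C) → (CB ⊎ C2 → C ⊎ C) →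
         CB ⊎ (C1 ⊎ C2) → C
aggMap σ1 σ2 (inj₁ b) = φ⁺ (σ1 (inj₁ b))
aggMap σ1 σ2 (inj₂ (inj₁ c)) = φ⁺ (σ1 (inj₂ c))
aggMap σ1 σ2 (inj₂ (inj₂ c)) = φ⁺ (σ2 (inj₂ c))

-- Write Y r = (-1)^ρ(r,1̂) g([r,1̂]^*) for r ∈ R. In the twins poset the dual interval above r is a
-- copy of [r,1̂]^* and the one above r⁻ is a pyramid over it, which has the same g-polynomial and the
-- opposite sign. Hence ℓ_{R±}(Γⁱ) = Σ h(Γⁱ_r) Y r - W, where W = Σ h((Γ_B)_r) Y r = ℓ_{R⁻}(Γ_B).
-- Over r the agglutination is Γ¹_r ∪ Γ²_r glued along (Γ_B)_r, of rank one less, and the defining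
-- sums give h((Γ¹♯Γ²)_r) = h(Γ¹_r) + h(Γ²_r) + (t - 1) h((Γ_B)_r). Summing against Y r,
-- ℓ_R(Γ¹♯Γ²) = U + V + (t - 1) W = (U - W) + (V - W) + (t + 1) W.

module Submission where

open import Data.Bool using (Bool; true; false; _∧_; not; if_then_else_; T)
open import Data.Bool.Properties using (∧-conicalˡ; ∧-conicalʳ; ∧-comm; ∧-assoc; ∧-zeroʳ; ∧-identityʳ)
open import Data.Empty using (⊥-elim)
open import Data.Integer as ℤ using (ℤ; +_; -_; _+_; _*_)
import Data.Integer.Properties as ℤ
open import Data.Integer.Tactic.RingSolver using (solve-∀)
open import Algebra.Properties.CommutativeSemigroup ℤ.+-commutativeSemigroup
  using () renaming (interchange to +-interchange; x∙yz≈y∙xz to +-left-comm)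
open import Data.List using (List; []; _∷_; map; _++_; length; mapMaybe)
open import Data.List.Properties using (length-++; length-map)
open import Data.List.Membership.Propositional using (_∈_; find)
open import Data.List.Membership.Propositional.Properties using (∈-map⁺; ∈-map⁻; ∈-++⁺ˡ; ∈-++⁺ʳ; ∈-++⁻; ∈-∃++)
import Data.List.Relation.Unary.All as All
open import Data.List.Relation.Unary.Any as Any using (Any; here; there; any?)
open import Data.List.Relation.Unary.Unique.Propositional using (Unique; []; _∷_)
import Data.List.Relation.Unary.Unique.Propositional.Properties as Unique
open import Data.Nat as ℕ using (ℕ; zero; suc; _∸_; z≤n; s≤s; _<ᵇ_; _≤ᵇ_)
import Data.Nat.Properties as ℕ
open import Data.Product using (_×_; _,_; ∃-syntax; proj₁; proj₂)
open import Data.Sum using (_⊎_; inj₁; inj₂)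
open import Data.Sum.Properties using (inj₁-injective; inj₂-injective)
open import Function using (_∘_; flip; case_of_; mk⇔)
open import Level using (0ℓ)
open import Relation.Binary using (Setoid; IsPartialOrder; DecidableEquality)
open import Relation.Binary.PropositionalEquality
  using (_≡_; _≢_; refl; sym; trans; cong; cong₂; subst; subst₂; module ≡-Reasoning)
import Relation.Binary.Reasoning.Setoid as SetoidReasoning
open import Relation.Nullary using (¬_; Dec; yes; no; does)
open import Relation.Nullary.Decidable using (dec-true; dec-false; does-⇔; _×-dec_; ¬?)

open import Defs

T⇒≡true : ∀ {b} → T b → b ≡ true
T⇒≡true {true} _ = refl

≡true⇒T : ∀ {b} → b ≡ true → T b
≡true⇒T refl = _

does-true⇒ : ∀ {A : Set} (a? : Dec A) → does a? ≡ true → A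
does-true⇒ (yes a) _ = a

not-does⇒¬ : ∀ {A : Set} (a? : Dec A) → not (does a?) ≡ true → ¬ A
not-does⇒¬ (no ¬a) _ = ¬a

infix 4 _≈_

_≈_ : Poly → Poly → Set
p ≈ q = ∀ k → p k ≡ q k

≈-setoid : Setoid 0ℓ 0ℓ
≈-setoid = record
  { Carrier = Poly
  ; _≈_ = _≈_
  ; isEquivalence = record
    { refl = λ _ → refl
    ; sym = λ p≈q k → sym (p≈q k)
    ; trans = λ p≈q q≈r k → trans (p≈q k) (q≈r k)
    }
  }

open Setoid ≈-setoid public using () renaming (refl to ≈-refl; reflexive to ≈-reflexive; sym to ≈-sym; trans to ≈-trans)

module ≈-Reasoning = SetoidReasoning ≈-setoid

⊕-cong : ∀ {p p′ q q′} → p ≈ p′ → q ≈ q′ → p ⊕ q ≈ p′ ⊕ q′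
⊕-cong p≈p′ q≈q′ k = cong₂ _+_ (p≈p′ k) (q≈q′ k)

⊕-congʳ : ∀ p {q q′} → q ≈ q′ → p ⊕ q ≈ p ⊕ q′
⊕-congʳ p q≈q′ = ⊕-cong (≈-refl {p}) q≈q′

negP-cong : ∀ {p q} → p ≈ q → negP p ≈ negP q
negP-cong p≈q k = cong -_ (p≈q k)

⊕-transpose : ∀ {p q b} → p ≈ q ⊕ b → q ≈ p ⊕ negP b
⊕-transpose {p} {q} {b} p≈q+b k = sym (trans (cong (_+ - b k) (p≈q+b k)) (cancel (q k) (b k)))
  where
  cancel : ∀ x y → (x + y) + - y ≡ x
  cancel = solve-∀

•-cong : ∀ c {p q} → p ≈ q → c • p ≈ c • q
•-cong c p≈q k = cong (c *_) (p≈q k)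

•-negˡ : ∀ c p → (- c) • p ≈ negP (c • p)
•-negˡ c p k = sym (ℤ.neg-distribˡ-* c (p k))

sumUpTo-cong : ∀ {f g : ℕ → ℤ} n → (∀ i → i ℕ.≤ n → f i ≡ g i) → sumUpTo f n ≡ sumUpTo g n
sumUpTo-cong zero f≗g = f≗g 0 z≤n
sumUpTo-cong (suc n) f≗g =
  cong₂ _+_ (sumUpTo-cong n (λ i i≤n → f≗g i (ℕ.m≤n⇒m≤1+n i≤n))) (f≗g (suc n) ℕ.≤-refl)

sumUpTo-distrib-+ : ∀ (f g : ℕ → ℤ) n → sumUpTo (λ i → f i + g i) n ≡ sumUpTo f n + sumUpTo g n
sumUpTo-distrib-+ f g zero = refl
sumUpTo-distrib-+ f g (suc n) =
  trans (cong (_+ (f (suc n) + g (suc n))) (sumUpTo-distrib-+ f g n))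
        (+-interchange (sumUpTo f n) (sumUpTo g n) (f (suc n)) (g (suc n)))

sumUpTo-neg : ∀ (f : ℕ → ℤ) n → sumUpTo (λ i → - f i) n ≡ - sumUpTo f n
sumUpTo-neg f zero = refl
sumUpTo-neg f (suc n) =
  trans (cong (_+ - f (suc n)) (sumUpTo-neg f n)) (sym (ℤ.neg-distrib-+ (sumUpTo f n) (f (suc n))))

sumUpTo-vanishes : ∀ (f : ℕ → ℤ) n → (∀ i → i ℕ.≤ n → f i ≡ + 0) → sumUpTo f n ≡ + 0
sumUpTo-vanishes f zero f≡0 = f≡0 0 z≤n
sumUpTo-vanishes f (suc n) f≡0 =
  cong₂ _+_ (sumUpTo-vanishes f n (λ i i≤n → f≡0 i (ℕ.m≤n⇒m≤1+n i≤n))) (f≡0 (suc n) ℕ.≤-refl)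

sumUpTo-unfoldˡ : ∀ (f : ℕ → ℤ) n → sumUpTo f (suc n) ≡ f 0 + sumUpTo (f ∘ suc) n
sumUpTo-unfoldˡ f zero = refl
sumUpTo-unfoldˡ f (suc n) =
  trans (cong (_+ f (suc (suc n))) (sumUpTo-unfoldˡ f n)) (ℤ.+-assoc (f 0) (sumUpTo (f ∘ suc) n) _)

⊛-cong : ∀ {p p′ q q′} → p ≈ p′ → q ≈ q′ → p ⊛ q ≈ p′ ⊛ q′
⊛-cong p≈p′ q≈q′ k = sumUpTo-cong k (λ i _ → cong₂ _*_ (p≈p′ i) (q≈q′ (k ∸ i)))

⊛-congˡ : ∀ {p p′} q → p ≈ p′ → p ⊛ q ≈ p′ ⊛ q
⊛-congˡ q p≈p′ = ⊛-cong p≈p′ (≈-refl {q})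

⊛-congʳ : ∀ p {q q′} → q ≈ q′ → p ⊛ q ≈ p ⊛ q′
⊛-congʳ p q≈q′ = ⊛-cong (≈-refl {p}) q≈q′

⊛-distribˡ-⊕ : ∀ p q r → p ⊛ (q ⊕ r) ≈ p ⊛ q ⊕ p ⊛ r
⊛-distribˡ-⊕ p q r k =
  trans (sumUpTo-cong k (λ i _ → ℤ.*-distribˡ-+ (p i) (q (k ∸ i)) (r (k ∸ i)))) (sumUpTo-distrib-+ _ _ k)

⊛-distribʳ-⊕ : ∀ p q r → (p ⊕ q) ⊛ r ≈ p ⊛ r ⊕ q ⊛ r
⊛-distribʳ-⊕ p q r k =
  trans (sumUpTo-cong k (λ i _ → ℤ.*-distribʳ-+ (r (k ∸ i)) (p i) (q i))) (sumUpTo-distrib-+ _ _ k)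

⊛-negˡ : ∀ p q → negP p ⊛ q ≈ negP (p ⊛ q)
⊛-negˡ p q k =
  trans (sumUpTo-cong k (λ i _ → sym (ℤ.neg-distribˡ-* (p i) (q (k ∸ i))))) (sumUpTo-neg _ k)

⊛-negʳ : ∀ p q → p ⊛ negP q ≈ negP (p ⊛ q)
⊛-negʳ p q k =
  trans (sumUpTo-cong k (λ i _ → sym (ℤ.neg-distribʳ-* (p i) (q (k ∸ i))))) (sumUpTo-neg _ k)

⊛-zeroʳ : ∀ p → p ⊛ 0P ≈ 0P
⊛-zeroʳ p k = sumUpTo-vanishes _ k (λ i _ → ℤ.*-zeroʳ (p i))

⊛-identityˡ : ∀ q → 1P ⊛ q ≈ q
⊛-identityˡ q zero = ℤ.*-identityˡ (q 0)
⊛-identityˡ q (suc k) = begin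
  sumUpTo (λ i → 1P i * q (suc k ∸ i)) (suc k)   ≡⟨ sumUpTo-unfoldˡ _ k ⟩
  + 1 * q (suc k) + sumUpTo (λ i → + 0 * q (k ∸ i)) k
    ≡⟨ cong₂ _+_ (ℤ.*-identityˡ (q (suc k))) (sumUpTo-vanishes _ k (λ _ _ → refl)) ⟩
  q (suc k) + + 0                                ≡⟨ ℤ.+-identityʳ _ ⟩
  q (suc k)                                      ∎
  where open ≡-Reasoning

⊛-identityʳ : ∀ p → p ⊛ 1P ≈ p
⊛-identityʳ p zero = ℤ.*-identityʳ (p 0)
⊛-identityʳ p (suc k) = begin
  sumUpTo (λ i → p i * 1P (suc k ∸ i)) k + p (suc k) * 1P (k ∸ k)
    ≡⟨ cong₂ _+_ (sumUpTo-vanishes _ k below-top) (cong (λ j → p (suc k) * 1P j) (ℕ.n∸n≡0 k)) ⟩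
  + 0 + p (suc k) * + 1                            ≡⟨ ℤ.+-identityˡ _ ⟩
  p (suc k) * + 1                                  ≡⟨ ℤ.*-identityʳ _ ⟩
  p (suc k)                                        ∎
  where
  open ≡-Reasoning
  below-top : ∀ i → i ℕ.≤ k → p i * 1P (suc k ∸ i) ≡ + 0
  below-top i i≤k = trans (cong (λ j → p i * 1P j) (ℕ.+-∸-assoc 1 i≤k)) (ℤ.*-zeroʳ (p i))

shift : Poly → Poly
shift p zero = + 0
shift p (suc k) = p k

shift-⊛ : ∀ p q → shift p ⊛ q ≈ shift (p ⊛ q)
shift-⊛ p q zero = ℤ.*-zeroˡ (q 0)
shift-⊛ p q (suc k) =
  trans (sumUpTo-unfoldˡ _ k)
        (trans (cong (_+ (p ⊛ q) k) (ℤ.*-zeroˡ (q (suc k)))) (ℤ.+-identityˡ _))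

⊛-shift : ∀ p q → p ⊛ shift q ≈ shift (p ⊛ q)
⊛-shift p q zero = ℤ.*-zeroʳ (p 0)
⊛-shift p q (suc k) =
  trans (cong₂ _+_ (sumUpTo-cong k (λ i i≤k → cong (λ j → p i * shift q j) (ℕ.+-∸-assoc 1 i≤k)))
                   (trans (cong (λ j → p (suc k) * shift q j) (ℕ.n∸n≡0 k)) (ℤ.*-zeroʳ (p (suc k)))))
        (ℤ.+-identityʳ _)

-- the hypothesis says that l = l 0 + t
linear-⊛ : ∀ l q → (∀ i → l (suc i) ≡ 1P i) → l ⊛ q ≈ shift q ⊕ l 0 • q
linear-⊛ l q l₊ zero = sym (ℤ.+-identityˡ _)
linear-⊛ l q l₊ (suc k) = begin
  sumUpTo (λ i → l i * q (suc k ∸ i)) (suc k)              ≡⟨ sumUpTo-unfoldˡ _ k ⟩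
  l 0 * q (suc k) + sumUpTo (λ i → l (suc i) * q (k ∸ i)) k
    ≡⟨ cong (_+_ (l 0 * q (suc k))) (sumUpTo-cong k (λ i _ → cong (_* q (k ∸ i)) (l₊ i))) ⟩
  l 0 * q (suc k) + (1P ⊛ q) k                              ≡⟨ cong (_+_ (l 0 * q (suc k))) (⊛-identityˡ q k) ⟩
  l 0 * q (suc k) + q k                                     ≡⟨ ℤ.+-comm _ (q k) ⟩
  q k + l 0 * q (suc k)                                     ∎
  where open ≡-Reasoning

tm1P-⊛ : ∀ q → tm1P ⊛ q ≈ shift q ⊕ negP q
tm1P-⊛ q = ≈-trans (linear-⊛ tm1P q tm1P₊) (⊕-congʳ (shift q) (λ k → ℤ.-1*i≡-i (q k)))
  where
  tm1P₊ : ∀ i → tm1P (suc i) ≡ 1P i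
  tm1P₊ zero = refl
  tm1P₊ (suc i) = refl

tp1P-⊛ : ∀ q → tp1P ⊛ q ≈ shift q ⊕ q
tp1P-⊛ q = ≈-trans (linear-⊛ tp1P q tp1P₊) (⊕-congʳ (shift q) (λ k → ℤ.*-identityˡ (q k)))
  where
  tp1P₊ : ∀ i → tp1P (suc i) ≡ 1P i
  tp1P₊ zero = refl
  tp1P₊ (suc i) = refl

tm1P-⊛-assoc : ∀ p q → (tm1P ⊛ p) ⊛ q ≈ tm1P ⊛ (p ⊛ q)
tm1P-⊛-assoc p q = begin
  (tm1P ⊛ p) ⊛ q                 ≈⟨ ⊛-congˡ q (tm1P-⊛ p) ⟩
  (shift p ⊕ negP p) ⊛ q         ≈⟨ ⊛-distribʳ-⊕ (shift p) (negP p) q ⟩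
  shift p ⊛ q ⊕ negP p ⊛ q       ≈⟨ ⊕-cong (shift-⊛ p q) (⊛-negˡ p q) ⟩
  shift (p ⊛ q) ⊕ negP (p ⊛ q)   ≈⟨ tm1P-⊛ (p ⊛ q) ⟨
  tm1P ⊛ (p ⊛ q)                 ∎
  where open ≈-Reasoning

⊛-tm1P-comm : ∀ p q → p ⊛ (tm1P ⊛ q) ≈ tm1P ⊛ (p ⊛ q)
⊛-tm1P-comm p q = begin
  p ⊛ (tm1P ⊛ q)                 ≈⟨ ⊛-congʳ p (tm1P-⊛ q) ⟩
  p ⊛ (shift q ⊕ negP q)         ≈⟨ ⊛-distribˡ-⊕ p (shift q) (negP q) ⟩
  p ⊛ shift q ⊕ p ⊛ negP q       ≈⟨ ⊕-cong (⊛-shift p q) (⊛-negʳ p q) ⟩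
  shift (p ⊛ q) ⊕ negP (p ⊛ q)   ≈⟨ tm1P-⊛ (p ⊛ q) ⟨
  tm1P ⊛ (p ⊛ q)                 ∎
  where open ≈-Reasoning

module _ {X : Set} where

  ΣL-cong : ∀ (P : X → Bool) l {F G : X → Poly} → (∀ x → P x ≡ true → F x ≈ G x) →
            ΣL P l F ≈ ΣL P l G
  ΣL-cong P [] F≈G k = refl
  ΣL-cong P (x ∷ l) F≈G k with P x in Px
  ... | true = cong₂ _+_ (F≈G x Px k) (ΣL-cong P l F≈G k)
  ... | false = ΣL-cong P l F≈G k

  ΣL-cong-filter : ∀ {P Q : X → Bool} l (F : X → Poly) → (∀ x → P x ≡ Q x) → ΣL P l F ≡ ΣL Q l F
  ΣL-cong-filter [] F P≗Q = refl
  ΣL-cong-filter {P} {Q} (x ∷ l) F P≗Q rewrite P≗Q x | ΣL-cong-filter {P} {Q} l F P≗Q = refl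

  ΣL-distrib-⊕ : ∀ (P : X → Bool) l (F G : X → Poly) →
                 ΣL P l (λ x → F x ⊕ G x) ≈ ΣL P l F ⊕ ΣL P l G
  ΣL-distrib-⊕ P [] F G k = refl
  ΣL-distrib-⊕ P (x ∷ l) F G k with P x
  ... | true = trans (cong (_+_ (F x k + G x k)) (ΣL-distrib-⊕ P l F G k))
                     (+-interchange (F x k) (G x k) (ΣL P l F k) (ΣL P l G k))
  ... | false = ΣL-distrib-⊕ P l F G k

  ΣL-neg : ∀ (P : X → Bool) l (F : X → Poly) → ΣL P l (λ x → negP (F x)) ≈ negP (ΣL P l F)
  ΣL-neg P [] F k = refl
  ΣL-neg P (x ∷ l) F k with P x
  ... | true = trans (cong (_+_ (- F x k)) (ΣL-neg P l F k)) (sym (ℤ.neg-distrib-+ (F x k) (ΣL P l F k)))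
  ... | false = ΣL-neg P l F k

  ⊛-distribˡ-ΣL : ∀ p (P : X → Bool) l (F : X → Poly) → p ⊛ ΣL P l F ≈ ΣL P l (λ x → p ⊛ F x)
  ⊛-distribˡ-ΣL p P [] F = ⊛-zeroʳ p
  ⊛-distribˡ-ΣL p P (x ∷ l) F k with P x
  ... | true = trans (⊛-distribˡ-⊕ p (F x) (ΣL P l F) k) (cong (_+_ ((p ⊛ F x) k)) (⊛-distribˡ-ΣL p P l F k))
  ... | false = ⊛-distribˡ-ΣL p P l F k

  ΣL-vanishes : ∀ (P : X → Bool) l (F : X → Poly) → (∀ x → x ∈ l → P x ≡ true → F x ≈ 0P) →
                ΣL P l F ≈ 0P
  ΣL-vanishes P [] F F≈0 k = refl
  ΣL-vanishes P (x ∷ l) F F≈0 k with P x in Px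
  ... | true = cong₂ _+_ (F≈0 x (here refl) Px k) (ΣL-vanishes P l F (λ y y∈l → F≈0 y (there y∈l)) k)
  ... | false = ΣL-vanishes P l F (λ y y∈l → F≈0 y (there y∈l)) k

  ΣL-++ : ∀ (P : X → Bool) l l′ (F : X → Poly) → ΣL P (l ++ l′) F ≈ ΣL P l F ⊕ ΣL P l′ F
  ΣL-++ P [] l′ F k = sym (ℤ.+-identityˡ _)
  ΣL-++ P (x ∷ l) l′ F k with P x
  ... | true = trans (cong (_+_ (F x k)) (ΣL-++ P l l′ F k)) (sym (ℤ.+-assoc (F x k) _ _))
  ... | false = ΣL-++ P l l′ F k

  ΣL-split : ∀ (P Q : X → Bool) l (F : X → Poly) →
             ΣL P l F ≈ ΣL (λ x → P x ∧ Q x) l F ⊕ ΣL (λ x → P x ∧ not (Q x)) l F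
  ΣL-split P Q [] F k = refl
  ΣL-split P Q (x ∷ l) F k with P x | Q x
  ... | true | true = trans (cong (_+_ (F x k)) (ΣL-split P Q l F k)) (sym (ℤ.+-assoc (F x k) _ _))
  ... | true | false = trans (cong (_+_ (F x k)) (ΣL-split P Q l F k))
    (+-left-comm (F x k) (ΣL (λ x → P x ∧ Q x) l F k) (ΣL (λ x → P x ∧ not (Q x)) l F k))
  ... | false | _ = ΣL-split P Q l F k

ΣL-map : ∀ {X Y : Set} (P : Y → Bool) (h : X → Y) l (F : Y → Poly) →
         ΣL P (map h l) F ≡ ΣL (P ∘ h) l (F ∘ h)
ΣL-map P h [] F = refl
ΣL-map P h (x ∷ l) F rewrite ΣL-map P h l F = refl

module _ {X : Set} where

  record Removal (P : X → Bool) (F : X → Poly) (x : X) (l : List X) : Set where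
    field
      rest : List X
      ΣL-rest : ΣL P l F ≈ ΣL P (x ∷ rest) F
      rest-unique : Unique rest
      rest⊆l : ∀ {y} → y ∈ rest → y ∈ l
      x∉rest : ∀ {y} → y ∈ rest → y ≢ x
      l∖x⊆rest : ∀ {y} → y ∈ l → y ≢ x → y ∈ rest

  remove : ∀ (P : X → Bool) (F : X → Poly) {x l} → x ∈ l → Unique l → Removal P F x l
  remove P F (here refl) (x∉l ∷ l!) = record
    { rest = _ ; ΣL-rest = ≈-refl ; rest-unique = l! ; rest⊆l = there
    ; x∉rest = λ y∈l y≡x → All.lookup x∉l y∈l (sym y≡x)
    ; l∖x⊆rest = λ { (here refl) y≢x → ⊥-elim (y≢x refl) ; (there y∈l) _ → y∈l } }
  remove P F {x} {w ∷ l} (there x∈l) (w∉l ∷ l!) = record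
    { rest = w ∷ rest
    ; ΣL-rest = swap-head
    ; rest-unique = All.tabulate (λ y∈rest → All.lookup w∉l (rest⊆l y∈rest)) ∷ rest-unique
    ; rest⊆l = λ { (here refl) → here refl ; (there y∈rest) → there (rest⊆l y∈rest) }
    ; x∉rest = λ { (here refl) w≡x → All.lookup w∉l x∈l w≡x ; (there y∈rest) → x∉rest y∈rest }
    ; l∖x⊆rest = λ { (here refl) _ → here refl ; (there y∈l) y≢x → there (l∖x⊆rest y∈l y≢x) } }
    where
    open Removal (remove P F x∈l l!)
    swap-head : ΣL P (w ∷ l) F ≈ ΣL P (x ∷ w ∷ rest) F
    swap-head k with P w | P x | ΣL-rest k
    ... | true | true | e = trans (cong (_+_ (F w k)) e) (+-left-comm (F w k) (F x k) (ΣL P rest F k))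
    ... | true | false | e = cong (_+_ (F w k)) e
    ... | false | _ | e = e

  ΣL-selected : ∀ (P : X → Bool) {x l} {F : X → Poly} → P x ≡ true → ΣL P (x ∷ l) F ≡ F x ⊕ ΣL P l F
  ΣL-selected P Px rewrite Px = refl

  ΣL-sameElements : ∀ (P : X → Bool) (F : X → Poly) l l′ → Unique l → Unique l′ →
    (∀ {y} → P y ≡ true → y ∈ l → y ∈ l′) → (∀ {y} → P y ≡ true → y ∈ l′ → y ∈ l) →
    ΣL P l F ≈ ΣL P l′ F
  ΣL-sameElements P F [] l′ _ _ _ l′⊆l =
    ≈-sym (ΣL-vanishes P l′ F (λ y y∈l′ Py → case l′⊆l Py y∈l′ of λ ()))
  ΣL-sameElements P F (x ∷ l) l′ (x∉l ∷ l!) l′! l⊆l′ l′⊆l with P x in Px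
  ... | false = ΣL-sameElements P F l l′ l! l′! (λ Py y∈l → l⊆l′ Py (there y∈l)) l′⊆tail
    where
    l′⊆tail : ∀ {y} → P y ≡ true → y ∈ l′ → y ∈ l
    l′⊆tail Py y∈l′ with l′⊆l Py y∈l′
    ... | here refl = case trans (sym Py) Px of λ ()
    ... | there y∈l = y∈l
  ... | true = begin
    F x ⊕ ΣL P l F       ≈⟨ ⊕-congʳ (F x) IH ⟩
    F x ⊕ ΣL P rest F    ≡⟨ ΣL-selected P {l = rest} {F} Px ⟨
    ΣL P (x ∷ rest) F    ≈⟨ ΣL-rest ⟨
    ΣL P l′ F            ∎
    where
    open ≈-Reasoning
    open Removal (remove P F (l⊆l′ Px (here refl)) l′!)
    IH : ΣL P l F ≈ ΣL P rest F
    IH = ΣL-sameElements P F l rest l! rest-unique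
      (λ Py y∈l → l∖x⊆rest (l⊆l′ Py (there y∈l)) (λ y≡x → All.lookup x∉l y∈l (sym y≡x)))
      (λ Py y∈rest → tail (l′⊆l Py (rest⊆l y∈rest)) (x∉rest y∈rest))
      where
      tail : ∀ {y} → y ∈ x ∷ l → y ≢ x → y ∈ l
      tail (here y≡x) y≢x = ⊥-elim (y≢x y≡x)
      tail (there y∈l) _ = y∈l

ΣL-reindex : ∀ {X Y : Set} (h : X → Y) (P : X → Bool) (P′ : Y → Bool) (F : X → Poly) (F′ : Y → Poly)
  (es : List X) (es′ : List Y) →
  (∀ {x y} → h x ≡ h y → x ≡ y) → Unique es → Unique es′ →
  (∀ x → x ∈ es) → (∀ y → y ∈ es′) →
  (∀ x → P′ (h x) ≡ P x) → (∀ y → P′ y ≡ true → ∃[ x ] h x ≡ y) →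
  (∀ x → P x ≡ true → F′ (h x) ≈ F x) →
  ΣL P′ es′ F′ ≈ ΣL P es F
ΣL-reindex h P P′ F F′ es es′ h-inj es! es′! ∈es ∈es′ P′∘h≗P P′⊆im F′∘h≈F = begin
  ΣL P′ es′ F′              ≈⟨ ΣL-sameElements P′ F′ (map h es) es′ (Unique.map⁺ h-inj es!) es′!
                                 (λ _ _ → ∈es′ _) ∈image ⟨
  ΣL P′ (map h es) F′       ≡⟨ ΣL-map P′ h es F′ ⟩
  ΣL (P′ ∘ h) es (F′ ∘ h)   ≡⟨ ΣL-cong-filter es (F′ ∘ h) P′∘h≗P ⟩
  ΣL P es (F′ ∘ h)          ≈⟨ ΣL-cong P es F′∘h≈F ⟩
  ΣL P es F                 ∎
  where
  open ≈-Reasoning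
  ∈image : ∀ {y} → P′ y ≡ true → y ∈ es′ → y ∈ map h es
  ∈image {y} P′y _ with P′⊆im y P′y
  ... | x , refl = ∈-map⁺ h (∈es x)

Deg≤ : Poly → ℕ → Set
Deg≤ p n = ∀ k → n ℕ.< k → p k ≡ + 0

Deg≤-mono : ∀ {p m n} → m ℕ.≤ n → Deg≤ p m → Deg≤ p n
Deg≤-mono m≤n p≤m k n<k = p≤m k (ℕ.≤-<-trans m≤n n<k)

Deg≤-⊛ : ∀ {p q a b} → Deg≤ p a → Deg≤ q b → Deg≤ (p ⊛ q) (a ℕ.+ b)
Deg≤-⊛ {p} {q} {a} {b} p≤a q≤b k a+b<k = sumUpTo-vanishes _ k term
  where
  term : ∀ i → i ℕ.≤ k → p i * q (k ∸ i) ≡ + 0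
  term i i≤k with a ℕ.<? i
  ... | yes a<i = trans (cong (_* q (k ∸ i)) (p≤a i a<i)) (ℤ.*-zeroˡ (q (k ∸ i)))
  ... | no a≮i = trans (cong (p i *_) (q≤b (k ∸ i) b<k∸i)) (ℤ.*-zeroʳ (p i))
    where
    b<k∸i : b ℕ.< k ∸ i
    b<k∸i = ℕ.m+n≤o⇒m≤o∸n (suc b)
              (ℕ.≤-trans (s≤s (ℕ.+-monoʳ-≤ b (ℕ.≮⇒≥ a≮i))) (subst (ℕ._< k) (ℕ.+-comm a b) a+b<k))

Deg≤-1P : ∀ n → Deg≤ 1P n
Deg≤-1P n (suc k) _ = refl

Deg≤-powP-tm1P : ∀ m → Deg≤ (powP tm1P m) m
Deg≤-powP-tm1P zero = Deg≤-1P 0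
Deg≤-powP-tm1P (suc m) = Deg≤-⊛ tm1P≤1 (Deg≤-powP-tm1P m)
  where
  tm1P≤1 : Deg≤ tm1P 1
  tm1P≤1 (suc zero) (s≤s ())
  tm1P≤1 (suc (suc k)) _ = refl

Deg≤-ΣL : ∀ {X : Set} (P : X → Bool) l (F : X → Poly) n → (∀ x → P x ≡ true → Deg≤ (F x) n) →
          Deg≤ (ΣL P l F) n
Deg≤-ΣL P [] F n F≤n k n<k = refl
Deg≤-ΣL P (x ∷ l) F n F≤n k n<k with P x in Px
... | true = cong₂ _+_ (F≤n x Px k n<k) (Deg≤-ΣL P l F n F≤n k n<k)
... | false = Deg≤-ΣL P l F n F≤n k n<k

truncP-cong : ∀ d {p q} → p ≈ q → truncP d p ≈ truncP d q
truncP-cong d p≈q k with (k ℕ.* 2) <ᵇ d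
... | true = p≈q k
... | false = refl

truncP-low : ∀ d p k → k ℕ.* 2 ℕ.< d → truncP d p k ≡ p k
truncP-low d p k 2k<d rewrite T⇒≡true (ℕ.<⇒<ᵇ 2k<d) = refl

truncP-high : ∀ d p k → ¬ (k ℕ.* 2 ℕ.< d) → truncP d p k ≡ + 0
truncP-high d p k 2k≮d with (k ℕ.* 2) <ᵇ d in 2k<ᵇd
... | false = refl
... | true = ⊥-elim (2k≮d (ℕ.<ᵇ⇒< (k ℕ.* 2) d (≡true⇒T 2k<ᵇd)))

Deg≤-truncP : ∀ d p → Deg≤ (truncP (suc d) p) d
Deg≤-truncP d p k d<k = truncP-high (suc d) p k (λ 2k<1+d → ℕ.<⇒≱ d<k (ℕ.≤-trans (ℕ.m≤m*n k 2) (ℕ.≤-pred 2k<1+d)))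

revP-low : ∀ r p k → k ℕ.≤ r → revP r p k ≡ p (r ∸ k)
revP-low r p k k≤r rewrite T⇒≡true (ℕ.≤⇒≤ᵇ k≤r) = refl

revP-high : ∀ r p k → r ℕ.< k → revP r p k ≡ + 0
revP-high r p k r<k with k ≤ᵇ r in k≤ᵇr
... | false = refl
... | true = ⊥-elim (ℕ.<⇒≱ r<k (ℕ.≤ᵇ⇒≤ k r (≡true⇒T k≤ᵇr)))

revP-cong : ∀ r {p q} → p ≈ q → revP r p ≈ revP r q
revP-cong r p≈q k with k ≤ᵇ r
... | true = p≈q (r ∸ k)
... | false = refl

revP-⊕ : ∀ r p q → revP r (p ⊕ q) ≈ revP r p ⊕ revP r q
revP-⊕ r p q k with k ≤ᵇ r
... | true = refl
... | false = refl

revP-negP : ∀ r p → revP r (negP p) ≈ negP (revP r p)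
revP-negP r p k with k ≤ᵇ r
... | true = refl
... | false = refl

-- t^(n+1) (t⁻¹ - 1) X(t⁻¹) = (1 - t) t^n X(t⁻¹)
revP-tm1P-⊛ : ∀ n X → Deg≤ X n → revP (suc n) (tm1P ⊛ X) ≈ revP n X ⊕ negP (shift (revP n X))
revP-tm1P-⊛ n X X≤n k = trans (revP-cong (suc n) (tm1P-⊛ X) k) (coefficient k)
  where
  coefficient : ∀ k → revP (suc n) (shift X ⊕ negP X) k ≡ (revP n X ⊕ negP (shift (revP n X))) k
  coefficient zero rewrite X≤n (suc n) ℕ.≤-refl | revP-low n X 0 z≤n = refl
  coefficient (suc k) with k ℕ.<? n | k ℕ.≟ n
  ... | yes k<n | _ rewrite revP-low (suc n) (shift X ⊕ negP X) (suc k) (s≤s (ℕ.<⇒≤ k<n))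
                          | revP-low n X k (ℕ.<⇒≤ k<n) | revP-low n X (suc k) k<n
                          | ℕ.+-∸-assoc 1 k<n = refl
  ... | no _ | yes refl rewrite revP-low (suc k) (shift X ⊕ negP X) (suc k) ℕ.≤-refl
                              | revP-low k X k ℕ.≤-refl | revP-high k X (suc k) ℕ.≤-refl
                              | ℕ.n∸n≡0 k = refl
  ... | no k≮n | no k≢n = past-end (ℕ.≤∧≢⇒< (ℕ.≮⇒≥ k≮n) (λ n≡k → k≢n (sym n≡k)))
    where
    past-end : n ℕ.< k → revP (suc n) (shift X ⊕ negP X) (suc k) ≡ (revP n X ⊕ negP (shift (revP n X))) (suc k)
    past-end n<k rewrite revP-high (suc n) (shift X ⊕ negP X) (suc k) (s≤s n<k)
                       | revP-high n X (suc k) (ℕ.m<n⇒m<1+n n<k) | revP-high n X k n<k = refl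

module GRecursion {C : Set} (es : List C) (_≟_ : DecidableEquality C) (le : C → C → Bool) (δ : C → C → ℕ) where

  g : ℕ → C → C → Poly
  g = gGen es _≟_ le δ

  [_,_⟩ : C → C → C → Bool
  [ a , b ⟩ z = le a z ∧ le z b ∧ not (does (z ≟ b))

  Deg≤-g : ∀ fuel a b → Deg≤ (g fuel a b) (δ a b)
  Deg≤-g zero a b = Deg≤-1P _
  Deg≤-g (suc fuel) a b = Deg≤-gStep (δ a b)
    where
    Deg≤-gStep : ∀ d → Deg≤ (gStep es _≟_ le δ fuel a b d) d
    Deg≤-gStep zero = Deg≤-1P 0
    Deg≤-gStep (suc d) k d<k =
      cong -_ (Deg≤-mono (ℕ.n≤1+n d) (Deg≤-truncP d (ΣL [ a , b ⟩ es (λ z → g fuel a z ⊛ powP tm1P (suc d ∸ δ a z)))) k d<k)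

  RankStrict : Set
  RankStrict = ∀ {a z b} → [ a , b ⟩ z ≡ true → δ a z ℕ.< δ a b

  g-fuel-irrelevant : RankStrict → ∀ fuel fuel′ a b → δ a b ℕ.< fuel → δ a b ℕ.< fuel′ →
                      g fuel a b ≈ g fuel′ a b
  g-fuel-irrelevant strict (suc fuel) (suc fuel′) a b δ<fuel δ<fuel′ = gStep-≈ (δ a b)
    where
    gStep-≈ : ∀ d → gStep es _≟_ le δ fuel a b d ≈ gStep es _≟_ le δ fuel′ a b d
    gStep-≈ zero = ≈-refl
    gStep-≈ (suc d) = negP-cong (truncP-cong (suc d) (ΣL-cong [ a , b ⟩ es λ z z∈ →
      ⊛-congˡ (powP tm1P (suc d ∸ δ a z))
        (g-fuel-irrelevant strict fuel fuel′ a z (ℕ.<-≤-trans (strict z∈) (ℕ.≤-pred δ<fuel))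
                                                 (ℕ.<-≤-trans (strict z∈) (ℕ.≤-pred δ<fuel′)))))

does-injective : ∀ {A B : Set} (_≟_ : DecidableEquality A) (_≟′_ : DecidableEquality B) (h : A → B) →
  (∀ {x y} → h x ≡ h y → x ≡ y) → ∀ x y → does (h x ≟′ h y) ≡ does (x ≟ y)
does-injective _≟_ _≟′_ h h-inj x y = does-⇔ (mk⇔ h-inj (cong h)) (h x ≟′ h y) (x ≟ y)

module GEmbedding {C C′ : Set}
  (es : List C) (_≟_ : DecidableEquality C) (le : C → C → Bool) (δ : C → C → ℕ)
  (es′ : List C′) (_≟′_ : DecidableEquality C′) (le′ : C′ → C′ → Bool) (δ′ : C′ → C′ → ℕ)
  (h : C → C′) (h-inj : ∀ {x y} → h x ≡ h y → x ≡ y)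
  (le′∘h : ∀ x y → le′ (h x) (h y) ≡ le x y) (δ′∘h : ∀ x y → δ′ (h x) (h y) ≡ δ x y)
  (lower : ∀ x′ y → le′ x′ (h y) ≡ true → ∃[ x ] h x ≡ x′)
  (es! : Unique es) (es′! : Unique es′) (∈es : ∀ x → x ∈ es) (∈es′ : ∀ x′ → x′ ∈ es′) where

  open GRecursion es _≟_ le δ using ([_,_⟩)
  open GRecursion es′ _≟′_ le′ δ′ using () renaming ([_,_⟩ to [_,_⟩′)

  g-embedding : ∀ fuel a b → gGen es′ _≟′_ le′ δ′ fuel (h a) (h b) ≈ gGen es _≟_ le δ fuel a b
  g-embedding zero a b = ≈-refl
  g-embedding (suc fuel) a b k =
    trans (cong (λ d → gStep es′ _≟′_ le′ δ′ fuel (h a) (h b) d k) (δ′∘h a b)) (gStep-≈ (δ a b) k)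
    where
    gStep-≈ : ∀ d → gStep es′ _≟′_ le′ δ′ fuel (h a) (h b) d ≈ gStep es _≟_ le δ fuel a b d
    gStep-≈ zero = ≈-refl
    gStep-≈ (suc d) = negP-cong (truncP-cong (suc d)
      (ΣL-reindex h [ a , b ⟩ [ h a , h b ⟩′ _ _ es es′ h-inj es! es′! ∈es ∈es′ same-filter in-image terms))
      where
      same-filter : ∀ x → [ h a , h b ⟩′ (h x) ≡ [ a , b ⟩ x
      same-filter x rewrite le′∘h a x | le′∘h x b | does-injective _≟_ _≟′_ h h-inj x b = refl
      in-image : ∀ y → [ h a , h b ⟩′ y ≡ true → ∃[ x ] h x ≡ y
      in-image y y∈ = lower y b (∧-conicalˡ _ _ (∧-conicalʳ (le′ (h a) y) _ y∈))
      terms : ∀ x → [ a , b ⟩ x ≡ true →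
        gGen es′ _≟′_ le′ δ′ fuel (h a) (h x) ⊛ powP tm1P (suc d ∸ δ′ (h a) (h x))
          ≈ gGen es _≟_ le δ fuel a x ⊛ powP tm1P (suc d ∸ δ a x)
      terms x _ rewrite δ′∘h a x = ⊛-congˡ (powP tm1P (suc d ∸ δ a x)) (g-embedding fuel a x)

countB : ∀ {X : Set} → (X → Bool) → List X → ℕ
countB Q [] = 0
countB Q (x ∷ l) = if Q x then suc (countB Q l) else countB Q l

module _ {X : Set} where

  countB-mono : ∀ (Q R : X → Bool) l → (∀ x → Q x ≡ true → R x ≡ true) → countB Q l ℕ.≤ countB R l
  countB-mono Q R [] Q⊆R = z≤n
  countB-mono Q R (x ∷ l) Q⊆R with Q x in Qx | R x in Rx
  ... | true | true = s≤s (countB-mono Q R l Q⊆R)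
  ... | true | false = case trans (sym (Q⊆R x Qx)) Rx of λ ()
  ... | false | true = ℕ.m≤n⇒m≤1+n (countB-mono Q R l Q⊆R)
  ... | false | false = countB-mono Q R l Q⊆R

  countB-strict : ∀ (Q R : X → Bool) l x → (∀ x → Q x ≡ true → R x ≡ true) →
                  x ∈ l → R x ≡ true → Q x ≡ false → countB Q l ℕ.< countB R l
  countB-strict Q R (y ∷ l) x Q⊆R (here refl) Rx Qx rewrite Rx | Qx = s≤s (countB-mono Q R l Q⊆R)
  countB-strict Q R (y ∷ l) x Q⊆R (there x∈l) Rx Qx with Q y in Qy | R y in Ry
  ... | true | true = s≤s (countB-strict Q R l x Q⊆R x∈l Rx Qx)
  ... | true | false = case trans (sym (Q⊆R y Qy)) Ry of λ ()
  ... | false | true = ℕ.m≤n⇒m≤1+n (countB-strict Q R l x Q⊆R x∈l Rx Qx)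
  ... | false | false = countB-strict Q R l x Q⊆R x∈l Rx Qx

  countB≤length : ∀ (R : X → Bool) l → countB R l ℕ.≤ length l
  countB≤length R [] = z≤n
  countB≤length R (x ∷ l) with R x
  ... | true = s≤s (countB≤length R l)
  ... | false = ℕ.m≤n⇒m≤1+n (countB≤length R l)

  maxL-lub : ∀ (Q : X → Bool) l (f : X → ℕ) m → (∀ y → y ∈ l → Q y ≡ true → f y ℕ.≤ m) → maxL Q l f ℕ.≤ m
  maxL-lub Q [] f m bounded = z≤n
  maxL-lub Q (x ∷ l) f m bounded with Q x in Qx
  ... | true = ℕ.⊔-lub (bounded x (here refl) Qx) (maxL-lub Q l f m (λ y y∈l → bounded y (there y∈l)))
  ... | false = maxL-lub Q l f m (λ y y∈l → bounded y (there y∈l))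

  maxL-ub : ∀ (Q : X → Bool) l (f : X → ℕ) y → y ∈ l → Q y ≡ true → f y ℕ.≤ maxL Q l f
  maxL-ub Q (x ∷ l) f y (here refl) Qy rewrite Qy = ℕ.m≤m⊔n (f y) _
  maxL-ub Q (x ∷ l) f y (there y∈l) Qy with Q x
  ... | true = ℕ.≤-trans (maxL-ub Q l f y y∈l Qy) (ℕ.m≤n⊔m (f x) _)
  ... | false = maxL-ub Q l f y y∈l Qy

  maxL-≡ : ∀ (Q : X → Bool) l (f : X → ℕ) m → (∀ y → y ∈ l → Q y ≡ true → f y ℕ.≤ m) →
           ∀ y → y ∈ l → Q y ≡ true → f y ≡ m → maxL Q l f ≡ m
  maxL-≡ Q l f m bounded y y∈l Qy fy≡m =
    ℕ.≤-antisym (maxL-lub Q l f m bounded) (subst (ℕ._≤ maxL Q l f) fy≡m (maxL-ub Q l f y y∈l Qy))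

  maxL-attained : ∀ (Q : X → Bool) l (f : X → ℕ) →
    (∃[ w ] (w ∈ l × Q w ≡ true × f w ≡ maxL Q l f)) ⊎ (∀ y → y ∈ l → Q y ≡ false)
  maxL-attained Q [] f = inj₂ (λ _ ())
  maxL-attained Q (x ∷ l) f with Q x in Qx | maxL-attained Q l f
  ... | false | inj₁ (w , w∈l , Qw , fw≡max) = inj₁ (w , there w∈l , Qw , fw≡max)
  ... | false | inj₂ none = inj₂ λ { y (here refl) → Qx ; y (there y∈l) → none y y∈l }
  ... | true | inj₂ none = inj₁ (x , here refl , Qx , sym (ℕ.m≥n⇒m⊔n≡m (ℕ.≤-trans max≤0 z≤n)))
    where
    max≤0 : maxL Q l f ℕ.≤ 0
    max≤0 = maxL-lub Q l f 0 (λ y y∈l Qy → case trans (sym Qy) (none y y∈l) of λ ())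
  ... | true | inj₁ (w , w∈l , Qw , fw≡max) with f x ℕ.≤? maxL Q l f
  ...   | yes fx≤max = inj₁ (w , there w∈l , Qw , trans fw≡max (sym (ℕ.m≤n⇒m⊔n≡n fx≤max)))
  ...   | no fx≰max = inj₁ (x , here refl , Qx , sym (ℕ.m≥n⇒m⊔n≡m (ℕ.<⇒≤ (ℕ.≰⇒> fx≰max))))

module FiniteRankedPoset {X : Set} (P : FinPoset X) (finite : IsFinite P)
  (partialOrder : IsPartialOrder _≡_ (FinPoset._≤_ P)) (ranked : FinPoset.Ranked P) where

  open FinPoset P
  open IsPartialOrder partialOrder using (antisym) renaming (refl to ≤-refl; trans to ≤-trans)

  ∈enum : ∀ x → x ∈ enum
  ∈enum = proj₁ finite

  ≤⇒leB : ∀ {x y} → x ≤ y → leB x y ≡ true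
  ≤⇒leB {x} {y} = dec-true (x ≤? y)

  leB⇒≤ : ∀ {x y} → leB x y ≡ true → x ≤ y
  leB⇒≤ {x} {y} = does-true⇒ (x ≤? y)

  [_,_] : X → X → X → Bool
  [ a , b ] w = leB a w ∧ leB w b

  ∣[_,_]∣ : X → X → ℕ
  ∣[ a , b ]∣ = countB [ a , b ] enum

  a∈[a,b] : ∀ {a b} → a ≤ b → [ a , b ] a ≡ true
  a∈[a,b] a≤b = cong₂ _∧_ (≤⇒leB ≤-refl) (≤⇒leB a≤b)

  b∈[a,b] : ∀ {a b} → a ≤ b → [ a , b ] b ≡ true
  b∈[a,b] a≤b = cong₂ _∧_ (≤⇒leB a≤b) (≤⇒leB ≤-refl)

  ∣[a,w]∣<∣[a,b]∣ : ∀ {a w b} → a ≤ b → w ≤ b → w ≢ b → ∣[ a , w ]∣ ℕ.< ∣[ a , b ]∣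
  ∣[a,w]∣<∣[a,b]∣ {a} {w} {b} a≤b w≤b w≢b =
    countB-strict [ a , w ] [ a , b ] enum b ⊆ (∈enum b) (b∈[a,b] a≤b) b∉[a,w]
    where
    ⊆ : ∀ x → [ a , w ] x ≡ true → [ a , b ] x ≡ true
    ⊆ x x∈ = cong₂ _∧_ (∧-conicalˡ _ _ x∈) (≤⇒leB (≤-trans (leB⇒≤ (∧-conicalʳ _ _ x∈)) w≤b))
    b∉[a,w] : [ a , w ] b ≡ false
    b∉[a,w] = trans (cong (leB a b ∧_) (dec-false (b ≤? w) (λ b≤w → w≢b (antisym w≤b b≤w)))) (∧-zeroʳ _)

  ∣[w,b]∣<∣[a,b]∣ : ∀ {a w b} → a ≤ b → a ≤ w → w ≢ a → ∣[ w , b ]∣ ℕ.< ∣[ a , b ]∣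
  ∣[w,b]∣<∣[a,b]∣ {a} {w} {b} a≤b a≤w w≢a =
    countB-strict [ w , b ] [ a , b ] enum a ⊆ (∈enum a) (a∈[a,b] a≤b) a∉[w,b]
    where
    ⊆ : ∀ x → [ w , b ] x ≡ true → [ a , b ] x ≡ true
    ⊆ x x∈ = cong₂ _∧_ (≤⇒leB (≤-trans a≤w (leB⇒≤ (∧-conicalˡ _ _ x∈)))) (∧-conicalʳ _ _ x∈)
    a∉[w,b] : [ w , b ] a ≡ false
    a∉[w,b] = cong (_∧ leB a b) (dec-false (w ≤? a) (λ w≤a → w≢a (antisym w≤a a≤w)))

  StrictlyBetween : X → X → X → Set
  StrictlyBetween a b w = a ≤ w × w ≤ b × w ≢ a × w ≢ b

  strictlyBetween? : ∀ a b w → Dec (StrictlyBetween a b w)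
  strictlyBetween? a b w = (a ≤? w) ×-dec (w ≤? b) ×-dec ¬? (w ≟ a) ×-dec ¬? (w ≟ b)

  covers : ∀ {a b} → a ≤ b → a ≢ b → ¬ Any (StrictlyBetween a b) enum → Covers a b
  covers {a} {b} a≤b a≢b none = a≤b , a≢b , endpoint
    where
    endpoint : ∀ w → a ≤ w → w ≤ b → w ≡ a ⊎ w ≡ b
    endpoint w a≤w w≤b with w ≟ a | w ≟ b
    ... | yes w≡a | _ = inj₁ w≡a
    ... | no _ | yes w≡b = inj₂ w≡b
    ... | no w≢a | no w≢b = ⊥-elim (none (Any.map (λ { refl → a≤w , w≤b , w≢a , w≢b }) (∈enum w)))

  ρ-strict-bounded : ∀ n {a b} → ∣[ a , b ]∣ ℕ.< n → a ≤ b → a ≢ b → ρ a ℕ.< ρ b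
  ρ-strict-bounded (suc n) {a} {b} size<n a≤b a≢b with any? (strictlyBetween? a b) enum
  ... | no none = subst (ρ a ℕ.<_) (sym (ranked a b (covers a≤b a≢b none))) ℕ.≤-refl
  ... | yes some with find some
  ...   | w , _ , (a≤w , w≤b , w≢a , w≢b) = ℕ.<-trans ρa<ρw ρw<ρb
    where
    ρa<ρw : ρ a ℕ.< ρ w
    ρa<ρw = ρ-strict-bounded n (ℕ.<-≤-trans (∣[a,w]∣<∣[a,b]∣ a≤b w≤b w≢b) (ℕ.≤-pred size<n))
                                a≤w (λ a≡w → w≢a (sym a≡w))
    ρw<ρb : ρ w ℕ.< ρ b
    ρw<ρb = ρ-strict-bounded n (ℕ.<-≤-trans (∣[w,b]∣<∣[a,b]∣ a≤b a≤w w≢a) (ℕ.≤-pred size<n)) w≤b w≢b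

  ρ-strict : ∀ {a b} → a ≤ b → a ≢ b → ρ a ℕ.< ρ b
  ρ-strict = ρ-strict-bounded _ ℕ.≤-refl

  ρ-mono : ∀ {a b} → a ≤ b → ρ a ℕ.≤ ρ b
  ρ-mono {a} {b} a≤b with a ≟ b
  ... | yes refl = ℕ.≤-refl
  ... | no a≢b = ℕ.<⇒≤ (ρ-strict a≤b a≢b)

  [_,_⟩ : X → X → X → Bool
  [ a , b ⟩ w = [ a , b ] w ∧ not (does (w ≟ b))

  rank-gap-bounded : ∀ n {a b} → ∣[ a , b ]∣ ℕ.< n → a ≤ b → ρ b ∸ ρ a ℕ.< ∣[ a , b ]∣
  rank-gap-bounded (suc n) {a} {b} size<n a≤b with a ≟ b
  ... | yes refl rewrite ℕ.n∸n≡0 (ρ a) = ℕ.≤-trans (s≤s z≤n)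
    (countB-strict (λ _ → false) [ a , a ] enum a (λ _ ()) (∈enum a) (a∈[a,b] ≤-refl) refl)
  ... | no a≢b with maxL-attained [ a , b ⟩ enum ρ
  ...   | inj₂ none = case trans (sym (none a (∈enum a))) a∈[a,b⟩ of λ ()
    where
    a∈[a,b⟩ : [ a , b ⟩ a ≡ true
    a∈[a,b⟩ = cong₂ _∧_ (a∈[a,b] a≤b) (cong not (dec-false (a ≟ b) a≢b))
  ...   | inj₁ (w , _ , w∈ , ρw≡max) = begin-strict
    ρ b ∸ ρ a         ≡⟨ cong (_∸ ρ a) (ranked w b w⋖b) ⟩
    suc (ρ w) ∸ ρ a   ≡⟨ ℕ.+-∸-assoc 1 (ρ-mono a≤w) ⟩
    suc (ρ w ∸ ρ a)   <⟨ s≤s (rank-gap-bounded n (ℕ.<-≤-trans ∣[a,w]∣<∣[a,b]∣′ (ℕ.≤-pred size<n)) a≤w) ⟩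
    suc ∣[ a , w ]∣   ≤⟨ ∣[a,w]∣<∣[a,b]∣′ ⟩
    ∣[ a , b ]∣       ∎
    where
    open ℕ.≤-Reasoning
    a≤w : a ≤ w
    a≤w = leB⇒≤ (∧-conicalˡ _ _ (∧-conicalˡ ([ a , b ] w) _ w∈))
    w≤b : w ≤ b
    w≤b = leB⇒≤ (∧-conicalʳ (leB a w) _ (∧-conicalˡ ([ a , b ] w) _ w∈))
    w≢b : w ≢ b
    w≢b = not-does⇒¬ (w ≟ b) (∧-conicalʳ ([ a , b ] w) _ w∈)
    ∣[a,w]∣<∣[a,b]∣′ : ∣[ a , w ]∣ ℕ.< ∣[ a , b ]∣
    ∣[a,w]∣<∣[a,b]∣′ = ∣[a,w]∣<∣[a,b]∣ a≤b w≤b w≢b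
    w⋖b : Covers w b
    w⋖b = w≤b , w≢b , endpoint
      where
      endpoint : ∀ v → w ≤ v → v ≤ b → v ≡ w ⊎ v ≡ b
      endpoint v w≤v v≤b with v ≟ w | v ≟ b
      ... | yes v≡w | _ = inj₁ v≡w
      ... | no _ | yes v≡b = inj₂ v≡b
      ... | no v≢w | no v≢b = ⊥-elim (ℕ.<⇒≱ (ρ-strict w≤v (λ w≡v → v≢w (sym w≡v)))
              (subst (ρ v ℕ.≤_) (sym ρw≡max) (maxL-ub [ a , b ⟩ enum ρ v (∈enum v) v∈[a,b⟩)))
        where
        v∈[a,b⟩ : [ a , b ⟩ v ≡ true
        v∈[a,b⟩ = cong₂ _∧_ (cong₂ _∧_ (≤⇒leB (≤-trans a≤w w≤v)) (≤⇒leB v≤b))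
                            (cong not (dec-false (v ≟ b) v≢b))

  rank-gap<length : ∀ {a b} → a ≤ b → ρ b ∸ ρ a ℕ.< length enum
  rank-gap<length a≤b = ℕ.≤-trans (rank-gap-bounded _ ℕ.≤-refl a≤b) (countB≤length _ enum)

  g-rank-strict : GRecursion.RankStrict enum _≟_ leB δ
  g-rank-strict {a} {z} {b} z∈ = ℕ.∸-monoˡ-< (ρ-strict (leB⇒≤ z≤b) z≢b) (ρ-mono (leB⇒≤ a≤z))
    where
    a≤z : leB a z ≡ true
    a≤z = ∧-conicalˡ _ _ z∈
    z≤b : leB z b ≡ true
    z≤b = ∧-conicalˡ _ _ (∧-conicalʳ (leB a z) _ z∈)
    z≢b : z ≢ b
    z≢b = not-does⇒¬ (z ≟ b) (∧-conicalʳ (leB z b) _ (∧-conicalʳ (leB a z) _ z∈))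

  gGen≈gI : ∀ fuel {a b} → a ≤ b → δ a b ℕ.< fuel → gGen enum _≟_ leB δ fuel a b ≈ gI a b
  gGen≈gI fuel {a} {b} a≤b δ<fuel =
    GRecursion.g-fuel-irrelevant enum _≟_ leB δ g-rank-strict fuel (length enum) a b δ<fuel (rank-gap<length a≤b)

length-≤-⊆ : ∀ {A : Set} (xs ys : List A) → Unique xs → (∀ {x} → x ∈ xs → x ∈ ys) → length xs ℕ.≤ length ys
length-≤-⊆ [] ys _ _ = z≤n
length-≤-⊆ (x ∷ xs) ys (x∉xs ∷ xs!) xs⊆ys with ∈-∃++ (xs⊆ys (here refl))
... | ys₁ , ys₂ , refl = begin
  suc (length xs)                 ≤⟨ s≤s (length-≤-⊆ xs (ys₁ ++ ys₂) xs! xs⊆ys₁++ys₂) ⟩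
  suc (length (ys₁ ++ ys₂))       ≡⟨ cong suc (length-++ ys₁) ⟩
  suc (length ys₁ ℕ.+ length ys₂) ≡⟨ ℕ.+-suc (length ys₁) (length ys₂) ⟨
  length ys₁ ℕ.+ length (x ∷ ys₂) ≡⟨ length-++ ys₁ ⟨
  length (ys₁ ++ x ∷ ys₂)         ∎
  where
  open ℕ.≤-Reasoning
  xs⊆ys₁++ys₂ : ∀ {y} → y ∈ xs → y ∈ ys₁ ++ ys₂
  xs⊆ys₁++ys₂ y∈xs with ∈-++⁻ ys₁ (xs⊆ys (there y∈xs))
  ... | inj₁ y∈ys₁ = ∈-++⁺ˡ y∈ys₁
  ... | inj₂ (here refl) = ⊥-elim (All.lookup x∉xs y∈xs refl)
  ... | inj₂ (there y∈ys₂) = ∈-++⁺ʳ ys₁ y∈ys₂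

module _ {X Y : Set} (P : FinPoset X) (Q : FinPoset Y) (P-finite : IsFinite P) (Q-finite : IsFinite Q)
  (P-partialOrder : IsPartialOrder _≡_ (FinPoset._≤_ P)) (P-ranked : FinPoset.Ranked P)
  (h : X → Y) (h-inj : ∀ {x y} → h x ≡ h y → x ≡ y)
  (leB∘h : ∀ x y → FinPoset.leB Q (h x) (h y) ≡ FinPoset.leB P x y)
  (ρ∘h : ∀ x → FinPoset.ρ Q (h x) ≡ FinPoset.ρ P x)
  (lower : ∀ y x → FinPoset.leB Q y (h x) ≡ true → ∃[ x′ ] h x′ ≡ y) where

  private
    module P = FinPoset P
    module Q = FinPoset Q

  gI-embedding : ∀ {a b} → a P.≤ b → Q.gI (h a) (h b) ≈ P.gI a b
  gI-embedding {a} {b} a≤b =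
    ≈-trans (GEmbedding.g-embedding P.enum P._≟_ P.leB P.δ Q.enum Q._≟_ Q.leB Q.δ h h-inj leB∘h
               (λ x y → cong₂ _∸_ (ρ∘h y) (ρ∘h x)) lower
               (proj₂ P-finite) (proj₂ Q-finite) (proj₁ P-finite) (proj₁ Q-finite)
               (length Q.enum) a b)
            (FiniteRankedPoset.gGen≈gI P P-finite P-partialOrder P-ranked (length Q.enum) a≤b
               (ℕ.<-≤-trans (FiniteRankedPoset.rank-gap<length P P-finite P-partialOrder P-ranked a≤b) P≤Q))
    where
    P≤Q : length P.enum ℕ.≤ length Q.enum
    P≤Q = subst (ℕ._≤ length Q.enum) (length-map h P.enum)
            (length-≤-⊆ (map h P.enum) Q.enum (Unique.map⁺ h-inj (proj₂ P-finite)) (λ _ → proj₁ Q-finite _))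

shift-⊕ : ∀ p q → shift (p ⊕ q) ≈ shift p ⊕ shift q
shift-⊕ p q zero = refl
shift-⊕ p q (suc k) = refl

pyramid-sum-shape : ∀ X G → X ⊕ (tm1P ⊛ X ⊕ tm1P ⊛ G) ≈ shift (X ⊕ G) ⊕ negP G
pyramid-sum-shape X G k = begin
  X k + ((tm1P ⊛ X) k + (tm1P ⊛ G) k)                      ≡⟨ cong (_+_ (X k)) (cong₂ _+_ (tm1P-⊛ X k) (tm1P-⊛ G k)) ⟩
  X k + ((shift X k + - X k) + (shift G k + - G k))         ≡⟨ rearrange (X k) (shift X k) (shift G k) (G k) ⟩
  (shift X k + shift G k) + - G k                           ≡⟨ cong (_+ - G k) (shift-⊕ X G k) ⟨
  shift (X ⊕ G) k + - G k                                   ∎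
  where
  open ≡-Reasoning
  rearrange : ∀ x sx sg g → x + ((sx + - x) + (sg + - g)) ≡ (sx + sg) + - g
  rearrange = solve-∀

pyramid-truncation-base : ∀ X G → X ≈ 0P → G ≈ 1P → negP (truncP 1 (X ⊕ (tm1P ⊛ X ⊕ tm1P ⊛ G))) ≈ G
pyramid-truncation-base X G X≈0 G≈1 = begin
  negP (truncP 1 (X ⊕ (tm1P ⊛ X ⊕ tm1P ⊛ G)))
    ≈⟨ negP-cong (truncP-cong 1 (⊕-cong X≈0 (⊕-cong (⊛-congʳ tm1P X≈0) (⊛-congʳ tm1P G≈1)))) ⟩
  negP (truncP 1 (0P ⊕ (tm1P ⊛ 0P ⊕ tm1P ⊛ 1P)))
    ≈⟨ negP-cong (truncP-cong 1 (⊕-congʳ 0P (⊕-cong (⊛-zeroʳ tm1P) (⊛-identityʳ tm1P)))) ⟩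
  negP (truncP 1 (0P ⊕ (0P ⊕ tm1P)))             ≈⟨ constant-term ⟩
  1P                                            ≈⟨ G≈1 ⟨
  G                                             ∎
  where
  open ≈-Reasoning
  constant-term : negP (truncP 1 (0P ⊕ (0P ⊕ tm1P))) ≈ 1P
  constant-term zero = refl
  constant-term (suc k) = refl

pyramid-truncation-shifted : ∀ e X G → G ≈ negP (truncP (suc e) X) →
                             negP (truncP (suc (suc e)) (shift (X ⊕ G) ⊕ negP G)) ≈ G
pyramid-truncation-shifted e X G G≈ k = coefficient (k ℕ.* 2 ℕ.<? suc (suc e))
  where
  Y : Poly
  Y = shift (X ⊕ G) ⊕ negP G
  low-shift-vanishes : ∀ k → k ℕ.* 2 ℕ.< suc (suc e) → - (shift (X ⊕ G) k + - G k) ≡ G k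
  low-shift-vanishes zero _ = trans (cong -_ (ℤ.+-identityˡ _)) (ℤ.neg-involutive (G 0))
  low-shift-vanishes (suc j) 2j+2<e+2 = begin
    - ((X ⊕ G) j + - G (suc j))
      ≡⟨ cong (λ w → - (X j + w + - G (suc j))) (trans (G≈ j) (cong -_ (truncP-low (suc e) X j 2j<e+1))) ⟩
    - (X j + - X j + - G (suc j))  ≡⟨ cong (λ w → - (w + - G (suc j))) (ℤ.+-inverseʳ (X j)) ⟩
    - (+ 0 + - G (suc j))          ≡⟨ cong -_ (ℤ.+-identityˡ _) ⟩
    - - G (suc j)                  ≡⟨ ℤ.neg-involutive _ ⟩
    G (suc j)                      ∎
    where
    open ≡-Reasoning
    2j<e+1 : j ℕ.* 2 ℕ.< suc e
    2j<e+1 = ℕ.≤-pred (ℕ.m<n⇒m<1+n (ℕ.≤-pred 2j+2<e+2))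
  coefficient : Dec (k ℕ.* 2 ℕ.< suc (suc e)) → - truncP (suc (suc e)) Y k ≡ G k
  coefficient (yes 2k<e+2) = trans (cong -_ (truncP-low (suc (suc e)) Y k 2k<e+2)) (low-shift-vanishes k 2k<e+2)
  coefficient (no 2k≮e+2) = trans (cong -_ (truncP-high (suc (suc e)) Y k 2k≮e+2))
    (sym (trans (G≈ k) (cong -_ (truncP-high (suc e) X k (2k≮e+2 ∘ ℕ.m<n⇒m<1+n)))))

pyramid-truncation : ∀ e X G → G ≈ negP (truncP (suc e) X) →
                     negP (truncP (suc (suc e)) (X ⊕ (tm1P ⊛ X ⊕ tm1P ⊛ G))) ≈ G
pyramid-truncation e X G G≈ =
  ≈-trans (negP-cong (truncP-cong (suc (suc e)) (pyramid-sum-shape X G))) (pyramid-truncation-shifted e X G G≈)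

module _ {C : Set} (R : FinPoset C) where
  private
    module R′ = FinPoset R
    module R± = FinPoset (Twins R)

  twins-leB-plus : ∀ u r → R±.leB u (inj₂ r) ≡ R′.leB (φ⁺ u) r
  twins-leB-plus (inj₁ _) r = refl
  twins-leB-plus (inj₂ _) r = refl

  twins-leB-minus : ∀ u r → T (isMinus u) → R±.leB u (inj₁ r) ≡ R′.leB (φ⁺ u) r
  twins-leB-minus (inj₁ _) r _ = refl

  twins-leB-plus-minus : ∀ u r → T (isPlus u) → R±.leB u (inj₁ r) ≡ false
  twins-leB-plus-minus (inj₂ _) r _ = refl

module TwinsDual {C : Set} (R : FinPoset C) (finite : IsFinite R)
  (partialOrder : IsPartialOrder _≡_ (FinPoset._≤_ R)) (ranked : FinPoset.Ranked R) where

  open FinPoset R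
  open FiniteRankedPoset R finite partialOrder ranked using (∈enum; ≤⇒leB; leB⇒≤; ρ-strict; ρ-mono; rank-gap<length)
  open IsPartialOrder partialOrder using () renaming (refl to ≤-refl)
  module R± = FinPoset (Twins R)

  module D = GRecursion enum _≟_ (flip leB) (flip δ)
  module D± = GRecursion R±.enum R±._≟_ (flip R±.leB) (flip R±.δ)

  R±-unique : Unique R±.enum
  R±-unique = Unique.++⁺ (Unique.map⁺ inj₁-injective (proj₂ finite)) (Unique.map⁺ inj₂-injective (proj₂ finite)) disjoint
    where
    disjoint : ∀ {v} → ¬ (v ∈ map inj₁ enum × v ∈ map inj₂ enum)
    disjoint (v∈₁ , v∈₂) with ∈-map⁻ inj₁ v∈₁ | ∈-map⁻ inj₂ v∈₂
    ... | _ , _ , refl | _ , _ , ()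

  ∈R± : ∀ x → x ∈ R±.enum
  ∈R± (inj₁ x) = ∈-++⁺ˡ (∈-map⁺ inj₁ (∈enum x))
  ∈R± (inj₂ x) = ∈-++⁺ʳ (map inj₁ enum) (∈-map⁺ inj₂ (∈enum x))

  length-R± : length R±.enum ≡ length enum ℕ.+ length enum
  length-R± = trans (length-++ (map inj₁ enum)) (cong₂ ℕ._+_ (length-map inj₁ enum) (length-map inj₂ enum))

  D-strict : D.RankStrict
  D-strict {a} {z} {b} z∈ = ℕ.∸-monoʳ-< (ρ-strict (leB⇒≤ b≤z) (λ b≡z → z≢b (sym b≡z))) (ρ-mono (leB⇒≤ z≤a))
    where
    z≤a : leB z a ≡ true
    z≤a = ∧-conicalˡ _ _ z∈
    b≤z : leB b z ≡ true
    b≤z = ∧-conicalˡ _ _ (∧-conicalʳ (leB z a) _ z∈)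
    z≢b : z ≢ b
    z≢b = not-does⇒¬ (z ≟ b) (∧-conicalʳ (leB b z) _ (∧-conicalʳ (leB z a) _ z∈))

  G : C → C → Poly
  G a b = D.g (suc (δ b a)) a b

  D-g≈G : ∀ fuel a b → δ b a ℕ.< fuel → D.g fuel a b ≈ G a b
  D-g≈G fuel a b δ<fuel = D.g-fuel-irrelevant D-strict fuel (suc (δ b a)) a b δ<fuel ℕ.≤-refl

  D±-g-plus : ∀ fuel a c → D±.g fuel (inj₂ a) (inj₂ c) ≈ D.g fuel a c
  D±-g-plus = GEmbedding.g-embedding enum _≟_ (flip leB) (flip δ) R±.enum R±._≟_ (flip R±.leB) (flip R±.δ)
    inj₂ inj₂-injective (λ _ _ → refl) (λ _ _ → refl) lower (proj₂ finite) R±-unique ∈enum ∈R±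
    where
    lower : ∀ x′ y → flip R±.leB x′ (inj₂ y) ≡ true → ∃[ x ] inj₂ x ≡ x′
    lower (inj₂ x) y _ = x , refl

  -- Below a, the dual interval from a to b⁻ consists of c⁻ and c for b ≤ c ≤ a: it is the pyramid
  -- over [b,a]^*, and its defining sum is X + (t - 1) X + (t - 1) G a b.
  D±-g-minus : ∀ fuel {a b} → b ≤ a → suc (δ b a) ℕ.< fuel → D±.g fuel (inj₂ a) (inj₁ b) ≈ G a b
  D±-g-minus (suc fuel) {a} {b} b≤a 1+e<1+fuel = begin
    D±.g (suc fuel) (inj₂ a) (inj₁ b)
      ≡⟨ cong (gStep R±.enum R±._≟_ (flip R±.leB) (flip R±.δ) fuel (inj₂ a) (inj₁ b)) (ℕ.+-∸-assoc 1 (ρ-mono b≤a)) ⟩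
    negP (truncP (suc e) (ΣL D±.[ inj₂ a , inj₁ b ⟩ R±.enum term))
      ≈⟨ negP-cong (truncP-cong (suc e) twins-sum) ⟩
    negP (truncP (suc e) (X ⊕ (tm1P ⊛ X ⊕ tm1P ⊛ G a b)))
      ≈⟨ close e refl ⟩
    G a b ∎
    where
    open ≈-Reasoning
    e : ℕ
    e = δ b a
    term : C ⊎ C → Poly
    term w = D±.g fuel (inj₂ a) w ⊛ powP tm1P (suc e ∸ flip R±.δ (inj₂ a) w)
    X : Poly
    X = ΣL D.[ a , b ⟩ enum (λ c → G a c ⊛ powP tm1P (e ∸ δ c a))
    twins-sum : ΣL D±.[ inj₂ a , inj₁ b ⟩ R±.enum term ≈ X ⊕ (tm1P ⊛ X ⊕ tm1P ⊛ G a b)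
    twins-sum = begin
      ΣL P± R±.enum term
        ≈⟨ ΣL-++ P± (map inj₁ enum) (map inj₂ enum) term ⟩
      ΣL P± (map inj₁ enum) term ⊕ ΣL P± (map inj₂ enum) term
        ≡⟨ cong₂ _⊕_ (ΣL-map P± inj₁ enum term) (ΣL-map P± inj₂ enum term) ⟩
      ΣL D.[ a , b ⟩ enum (term ∘ inj₁) ⊕ ΣL (P± ∘ inj₂) enum (term ∘ inj₂)
        ≈⟨ ⊕-cong (ΣL-cong D.[ a , b ⟩ enum minus-term)
                  (ΣL-split (P± ∘ inj₂) (λ c → not (does (c ≟ b))) enum (term ∘ inj₂)) ⟩
      X ⊕ (ΣL (λ c → P± (inj₂ c) ∧ not (does (c ≟ b))) enum (term ∘ inj₂)
           ⊕ ΣL (λ c → P± (inj₂ c) ∧ not (not (does (c ≟ b)))) enum (term ∘ inj₂))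
        ≈⟨ ⊕-congʳ X (⊕-cong plus-interior plus-apex) ⟩
      X ⊕ (tm1P ⊛ X ⊕ tm1P ⊛ G a b) ∎
      where
      P± : C ⊎ C → Bool
      P± = D±.[ inj₂ a , inj₁ b ⟩
      δca<e : ∀ {c} → D.[ a , b ⟩ c ≡ true → δ c a ℕ.< e
      δca<e = D-strict
      e<fuel : e ℕ.< fuel
      e<fuel = ℕ.≤-pred 1+e<1+fuel
      minus-term : ∀ c → D.[ a , b ⟩ c ≡ true → term (inj₁ c) ≈ G a c ⊛ powP tm1P (e ∸ δ c a)
      minus-term c c∈ rewrite ℕ.+-∸-assoc 1 (ρ-mono (leB⇒≤ (∧-conicalˡ _ _ c∈))) =
        ⊛-congˡ (powP tm1P (e ∸ δ c a))
                (D±-g-minus fuel (leB⇒≤ (∧-conicalˡ _ _ c∈)) (ℕ.≤-trans (s≤s (δca<e c∈)) e<fuel))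
      plus-interior : ΣL (λ c → P± (inj₂ c) ∧ not (does (c ≟ b))) enum (term ∘ inj₂) ≈ tm1P ⊛ X
      plus-interior = begin
        ΣL (λ c → P± (inj₂ c) ∧ not (does (c ≟ b))) enum (term ∘ inj₂)
          ≡⟨ ΣL-cong-filter enum (term ∘ inj₂) (λ c →
               trans (cong (λ u → (leB c a ∧ u) ∧ not (does (c ≟ b))) (∧-identityʳ (leB b c)))
                     (∧-assoc (leB c a) (leB b c) _)) ⟩
        ΣL D.[ a , b ⟩ enum (term ∘ inj₂)
          ≈⟨ ΣL-cong D.[ a , b ⟩ enum plus-term ⟩
        ΣL D.[ a , b ⟩ enum (λ c → tm1P ⊛ (G a c ⊛ powP tm1P (e ∸ δ c a)))
          ≈⟨ ⊛-distribˡ-ΣL tm1P D.[ a , b ⟩ enum (λ c → G a c ⊛ powP tm1P (e ∸ δ c a)) ⟨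
        tm1P ⊛ X ∎
        where
        plus-term : ∀ c → D.[ a , b ⟩ c ≡ true → term (inj₂ c) ≈ tm1P ⊛ (G a c ⊛ powP tm1P (e ∸ δ c a))
        plus-term c c∈ rewrite ℕ.+-∸-assoc 1 (ℕ.<⇒≤ (δca<e c∈)) =
          ≈-trans (⊛-congˡ (powP tm1P (suc (e ∸ δ c a)))
                    (≈-trans (D±-g-plus fuel a c) (D-g≈G fuel a c (ℕ.<-trans (δca<e c∈) e<fuel))))
                  (⊛-tm1P-comm (G a c) (powP tm1P (e ∸ δ c a)))
      plus-apex : ΣL (λ c → P± (inj₂ c) ∧ not (not (does (c ≟ b)))) enum (term ∘ inj₂) ≈ tm1P ⊛ G a b
      plus-apex = begin
        ΣL P-apex enum (term ∘ inj₂)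
          ≈⟨ ΣL-sameElements P-apex (term ∘ inj₂) enum (b ∷ []) (proj₂ finite) (All.[] ∷ [])
               (λ c∈ _ → here (only-b c∈)) (λ _ _ → ∈enum _) ⟩
        ΣL P-apex (b ∷ []) (term ∘ inj₂)
          ≡⟨ ΣL-selected P-apex {b} {[]} {term ∘ inj₂} b-apex ⟩
        term (inj₂ b) ⊕ 0P
          ≈⟨ (λ k → ℤ.+-identityʳ (term (inj₂ b) k)) ⟩
        D±.g fuel (inj₂ a) (inj₂ b) ⊛ powP tm1P (suc e ∸ e)
          ≡⟨ cong (λ m → D±.g fuel (inj₂ a) (inj₂ b) ⊛ powP tm1P m) (ℕ.m+n∸n≡m 1 e) ⟩
        D±.g fuel (inj₂ a) (inj₂ b) ⊛ (tm1P ⊛ 1P)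
          ≈⟨ ⊛-congˡ (tm1P ⊛ 1P) (≈-trans (D±-g-plus fuel a b) (D-g≈G fuel a b e<fuel)) ⟩
        G a b ⊛ (tm1P ⊛ 1P)
          ≈⟨ ⊛-tm1P-comm (G a b) 1P ⟩
        tm1P ⊛ (G a b ⊛ 1P)
          ≈⟨ ⊛-congʳ tm1P (⊛-identityʳ (G a b)) ⟩
        tm1P ⊛ G a b ∎
        where
        P-apex : C → Bool
        P-apex c = P± (inj₂ c) ∧ not (not (does (c ≟ b)))
        only-b : ∀ {c} → P-apex c ≡ true → c ≡ b
        only-b {c} c∈ with c ≟ b
        ... | yes c≡b = c≡b
        ... | no _ = case ∧-conicalʳ (P± (inj₂ c)) false c∈ of λ ()
        b-apex : P-apex b ≡ true
        b-apex rewrite dec-true (b ≟ b) refl = cong (_∧ true) (cong₂ _∧_ (≤⇒leB b≤a) (cong (_∧ true) (≤⇒leB ≤-refl)))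
    close : ∀ d → d ≡ e → negP (truncP (suc d) (X ⊕ (tm1P ⊛ X ⊕ tm1P ⊛ G a b))) ≈ G a b
    close zero 0≡e = pyramid-truncation-base X (G a b) X≈0 G≈1
      where
      X≈0 : X ≈ 0P
      X≈0 = ΣL-vanishes D.[ a , b ⟩ enum _ (λ c _ c∈ → case subst (δ c a ℕ.<_) (sym 0≡e) (D-strict c∈) of λ ())
      G≈1 : G a b ≈ 1P
      G≈1 k = cong (λ d → gStep enum _≟_ (flip leB) (flip δ) e a b d k) (sym 0≡e)
    close (suc d) 1+d≡e = pyramid-truncation d X (G a b) G≈
      where
      G≈ : G a b ≈ negP (truncP (suc d) X)
      G≈ k = trans (cong (λ d′ → gStep enum _≟_ (flip leB) (flip δ) e a b d′ k) (sym 1+d≡e))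
        (negP-cong (truncP-cong (suc d) (ΣL-cong D.[ a , b ⟩ enum λ c c∈ →
           ⊛-cong (D-g≈G e a c (D-strict c∈)) (λ j → cong (λ d′ → powP tm1P (d′ ∸ δ c a) j) 1+d≡e))) k)

  gDual-twin-plus : ∀ {r top} → r ≤ top → R±.gDual (inj₂ r) (inj₂ top) ≈ gDual r top
  gDual-twin-plus {r} {top} r≤top = begin
    D±.g (length R±.enum) (inj₂ top) (inj₂ r)   ≈⟨ D±-g-plus (length R±.enum) top r ⟩
    D.g (length R±.enum) top r                  ≈⟨ D-g≈G _ top r gap<length-R± ⟩
    G top r                                     ≈⟨ D-g≈G _ top r (rank-gap<length r≤top) ⟨
    D.g (length enum) top r                     ∎
    where
    open ≈-Reasoning
    gap<length-R± : δ r top ℕ.< length R±.enum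
    gap<length-R± rewrite length-R± = ℕ.≤-trans (rank-gap<length r≤top) (ℕ.m≤m+n _ _)

  gDual-twin-minus : ∀ {r top} → r ≤ top → R±.gDual (inj₁ r) (inj₂ top) ≈ gDual r top
  gDual-twin-minus {r} {top} r≤top = begin
    D±.g (length R±.enum) (inj₂ top) (inj₁ r)   ≈⟨ D±-g-minus _ r≤top 1+gap<length-R± ⟩
    G top r                                     ≈⟨ D-g≈G _ top r gap<n ⟨
    D.g (length enum) top r                     ∎
    where
    open ≈-Reasoning
    n : ℕ
    n = length enum
    gap<n : δ r top ℕ.< n
    gap<n = rank-gap<length r≤top
    1+gap<length-R± : suc (δ r top) ℕ.< length R±.enum
    1+gap<length-R± rewrite length-R± =
      ℕ.<-≤-trans (s≤s gap<n) (subst (ℕ._≤ n ℕ.+ n) (ℕ.+-comm n 1) (ℕ.+-monoʳ-≤ n (ℕ.≤-trans (s≤s z≤n) gap<n)))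

  R±-refl : ∀ x → x R±.≤ x
  R±-refl (inj₁ r) = ≤-refl
  R±-refl (inj₂ r) = ≤-refl

  R±-ρ-mono : ∀ {u v} → u R±.≤ v → R±.ρ u ℕ.≤ R±.ρ v
  R±-ρ-mono {inj₁ _} {inj₁ _} u≤v = ρ-mono u≤v
  R±-ρ-mono {inj₁ _} {inj₂ _} u≤v = ℕ.m≤n⇒m≤1+n (ρ-mono u≤v)
  R±-ρ-mono {inj₂ _} {inj₂ _} u≤v = s≤s (ρ-mono u≤v)

  ΣR : (C → Poly) → Poly
  ΣR = ΣL (λ _ → true) enum

  signedGDual : C → C → Poly
  signedGDual top r = sgn (δ r top) • gDual r top

  ΣR± : ∀ (f : C ⊎ C → Poly) → ΣL (λ _ → true) R±.enum f ≈ ΣR (f ∘ inj₁) ⊕ ΣR (f ∘ inj₂)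
  ΣR± f k = trans (ΣL-++ (λ _ → true) (map inj₁ enum) (map inj₂ enum) f k)
    (cong₂ (λ p q → p k + q k) (ΣL-map (λ _ → true) inj₁ enum f) (ΣL-map (λ _ → true) inj₂ enum f))

  ℓ-over-twins : ∀ {D : Set} (Γ : FinPoset D) z (σ : D → C ⊎ C) top → (∀ r → r ≤ top) →
    ℓ Γ allP z (Twins R) (inj₂ top) σ
      ≈ negP (ΣR (λ r → FinPoset.hPoly Γ (λ y → R±.leB (σ y) (inj₁ r)) z ⊛ signedGDual top r))
        ⊕ ΣR (λ r → FinPoset.hPoly Γ (λ y → R±.leB (σ y) (inj₂ r)) z ⊛ signedGDual top r)
  ℓ-over-twins Γ z σ top ≤top = ≈-trans (ΣR± _) (⊕-cong minus-part (ΣL-cong _ enum plus-term))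
    where
    h : (C ⊎ C) → Poly
    h x = FinPoset.hPoly Γ (λ y → R±.leB (σ y) x) z
    minus-term : ∀ r → h (inj₁ r) ⊛ (sgn (R±.δ (inj₁ r) (inj₂ top)) • R±.gDual (inj₁ r) (inj₂ top))
                       ≈ negP (h (inj₁ r) ⊛ signedGDual top r)
    minus-term r = begin
      h (inj₁ r) ⊛ (sgn (R±.δ (inj₁ r) (inj₂ top)) • R±.gDual (inj₁ r) (inj₂ top))
        ≡⟨ cong (λ n → h (inj₁ r) ⊛ (sgn n • R±.gDual (inj₁ r) (inj₂ top))) (ℕ.+-∸-assoc 1 (ρ-mono (≤top r))) ⟩
      h (inj₁ r) ⊛ ((- sgn (δ r top)) • R±.gDual (inj₁ r) (inj₂ top))
        ≈⟨ ⊛-congʳ (h (inj₁ r)) (≈-trans (•-cong (- sgn (δ r top)) (gDual-twin-minus (≤top r)))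
                                        (•-negˡ (sgn (δ r top)) (gDual r top))) ⟩
      h (inj₁ r) ⊛ negP (signedGDual top r)
        ≈⟨ ⊛-negʳ (h (inj₁ r)) (signedGDual top r) ⟩
      negP (h (inj₁ r) ⊛ signedGDual top r) ∎
      where open ≈-Reasoning
    minus-part : ΣR (λ r → h (inj₁ r) ⊛ (sgn (R±.δ (inj₁ r) (inj₂ top)) • R±.gDual (inj₁ r) (inj₂ top)))
                 ≈ negP (ΣR (λ r → h (inj₁ r) ⊛ signedGDual top r))
    minus-part = ≈-trans (ΣL-cong _ enum (λ r _ → minus-term r)) (ΣL-neg _ enum _)
    plus-term : ∀ r → true ≡ true → h (inj₂ r) ⊛ (sgn (R±.δ (inj₂ r) (inj₂ top)) • R±.gDual (inj₂ r) (inj₂ top))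
                                    ≈ h (inj₂ r) ⊛ signedGDual top r
    plus-term r _ = ⊛-congʳ (h (inj₂ r)) (•-cong (sgn (δ r top)) (gDual-twin-plus (≤top r)))

emb2 : {CB C1 C2 : Set} → CB ⊎ C2 → CB ⊎ (C1 ⊎ C2)
emb2 (inj₁ b) = inj₁ b
emb2 (inj₂ c) = inj₂ (inj₂ c)

emb1-injective : ∀ {CB C1 C2 : Set} {x y : CB ⊎ C1} → emb1 {C2 = C2} x ≡ emb1 y → x ≡ y
emb1-injective {x = inj₁ _} {inj₁ _} refl = refl
emb1-injective {x = inj₂ _} {inj₂ _} refl = refl

emb2-injective : ∀ {CB C1 C2 : Set} {x y : CB ⊎ C2} → emb2 {C1 = C1} x ≡ emb2 y → x ≡ y
emb2-injective {x = inj₁ _} {inj₁ _} refl = refl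
emb2-injective {x = inj₂ _} {inj₂ _} refl = refl

module _ {CB C1 C2 : Set} where

  ∈-mapMaybe-int2⁻ : ∀ (l : List (CB ⊎ C2)) {y} → y ∈ mapMaybe (int2 {C1 = C1}) l →
                     ∃[ c ] (y ≡ inj₂ (inj₂ c) × inj₂ c ∈ l)
  ∈-mapMaybe-int2⁻ (inj₁ b ∷ l) y∈ with ∈-mapMaybe-int2⁻ l y∈
  ... | c , y≡c , c∈l = c , y≡c , there c∈l
  ∈-mapMaybe-int2⁻ (inj₂ c ∷ l) (here refl) = c , refl , here refl
  ∈-mapMaybe-int2⁻ (inj₂ c ∷ l) (there y∈) with ∈-mapMaybe-int2⁻ l y∈
  ... | c′ , y≡c′ , c′∈l = c′ , y≡c′ , there c′∈l

  ∈-mapMaybe-int2⁺ : ∀ (l : List (CB ⊎ C2)) {c} → inj₂ c ∈ l → inj₂ (inj₂ c) ∈ mapMaybe (int2 {C1 = C1}) l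
  ∈-mapMaybe-int2⁺ (inj₂ c ∷ l) (here refl) = here refl
  ∈-mapMaybe-int2⁺ (inj₁ b ∷ l) (there c∈l) = ∈-mapMaybe-int2⁺ l c∈l
  ∈-mapMaybe-int2⁺ (inj₂ _ ∷ l) (there c∈l) = there (∈-mapMaybe-int2⁺ l c∈l)

  mapMaybe-int2-unique : ∀ (l : List (CB ⊎ C2)) → Unique l → Unique (mapMaybe (int2 {C1 = C1}) l)
  mapMaybe-int2-unique [] _ = []
  mapMaybe-int2-unique (inj₁ b ∷ l) (_ ∷ l!) = mapMaybe-int2-unique l l!
  mapMaybe-int2-unique (inj₂ c ∷ l) (c∉l ∷ l!) = All.tabulate fresh ∷ mapMaybe-int2-unique l l!
    where
    fresh : ∀ {y} → y ∈ mapMaybe int2 l → inj₂ (inj₂ c) ≢ y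
    fresh y∈ c≡y with ∈-mapMaybe-int2⁻ l y∈
    fresh y∈ refl | _ , refl , c∈l = All.lookup c∉l c∈l refl

  ΣL-mapMaybe-int2 : ∀ (P : CB ⊎ (C1 ⊎ C2) → Bool) (l : List (CB ⊎ C2)) (F : CB ⊎ (C1 ⊎ C2) → Poly) →
    ΣL P (mapMaybe int2 l) F ≡ ΣL (λ y → isPlus y ∧ P (emb2 y)) l (F ∘ emb2)
  ΣL-mapMaybe-int2 P [] F = refl
  ΣL-mapMaybe-int2 P (inj₁ b ∷ l) F = ΣL-mapMaybe-int2 P l F
  ΣL-mapMaybe-int2 P (inj₂ c ∷ l) F rewrite ΣL-mapMaybe-int2 P l F = refl

module Agglutination {CB C1 C2 : Set} (Γ1 : FinPoset (CB ⊎ C1)) (Γ2 : FinPoset (CB ⊎ C2))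
  (finite₁ : IsFinite Γ1) (finite₂ : IsFinite Γ2)
  (partialOrder₁ : IsPartialOrder _≡_ (FinPoset._≤_ Γ1)) (ranked₁ : FinPoset.Ranked Γ1)
  (partialOrder₂ : IsPartialOrder _≡_ (FinPoset._≤_ Γ2)) (ranked₂ : FinPoset.Ranked Γ2)
  (boundary-lower₁ : ∀ c b → ¬ FinPoset._≤_ Γ1 (inj₂ c) (inj₁ b))
  (boundary-lower₂ : ∀ c b → ¬ FinPoset._≤_ Γ2 (inj₂ c) (inj₁ b))
  (agree : AgreeOnBoundary Γ1 Γ2) where

  module Γ₁ = FinPoset Γ1
  module Γ₂ = FinPoset Γ2
  module Γ♯ = FinPoset (Agg Γ1 Γ2)

  Γ♯-unique : Unique Γ♯.enum
  Γ♯-unique = Unique.++⁺ (Unique.map⁺ emb1-injective (proj₂ finite₁)) (mapMaybe-int2-unique Γ₂.enum (proj₂ finite₂)) disjoint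
    where
    disjoint : ∀ {v} → ¬ (v ∈ map emb1 Γ₁.enum × v ∈ mapMaybe int2 Γ₂.enum)
    disjoint (v∈₁ , v∈₂) with ∈-map⁻ emb1 v∈₁ | ∈-mapMaybe-int2⁻ Γ₂.enum v∈₂
    ... | inj₁ _ , _ , refl | _ , () , _
    ... | inj₂ _ , _ , refl | _ , () , _

  ∈Γ♯ : ∀ x → x ∈ Γ♯.enum
  ∈Γ♯ (inj₁ b) = ∈-++⁺ˡ (∈-map⁺ emb1 (proj₁ finite₁ (inj₁ b)))
  ∈Γ♯ (inj₂ (inj₁ c)) = ∈-++⁺ˡ (∈-map⁺ emb1 (proj₁ finite₁ (inj₂ c)))
  ∈Γ♯ (inj₂ (inj₂ c)) = ∈-++⁺ʳ (map emb1 Γ₁.enum) (∈-mapMaybe-int2⁺ Γ₂.enum (proj₁ finite₂ (inj₂ c)))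

  Γ♯-finite : IsFinite (Agg Γ1 Γ2)
  Γ♯-finite = ∈Γ♯ , Γ♯-unique

  leB∘emb1 : ∀ x y → Γ♯.leB (emb1 x) (emb1 y) ≡ Γ₁.leB x y
  leB∘emb1 (inj₁ a) (inj₁ b) = refl
  leB∘emb1 (inj₁ a) (inj₂ c) = refl
  leB∘emb1 (inj₂ c) (inj₁ b) = refl
  leB∘emb1 (inj₂ c) (inj₂ d) = refl

  ρ∘emb1 : ∀ x → Γ♯.ρ (emb1 x) ≡ Γ₁.ρ x
  ρ∘emb1 (inj₁ a) = refl
  ρ∘emb1 (inj₂ c) = refl

  lower₁ : ∀ y x → Γ♯.leB y (emb1 x) ≡ true → ∃[ x′ ] emb1 x′ ≡ y
  lower₁ (inj₁ b) x _ = inj₁ b , refl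
  lower₁ (inj₂ (inj₁ c)) x _ = inj₂ c , refl
  lower₁ (inj₂ (inj₂ c)) (inj₁ b) c≤b = ⊥-elim (boundary-lower₂ c b (does-true⇒ (Γ₂._≤?_ (inj₂ c) (inj₁ b)) c≤b))

  leB∘emb2 : ∀ x y → Γ♯.leB (emb2 x) (emb2 y) ≡ Γ₂.leB x y
  leB∘emb2 (inj₁ a) (inj₁ b) =
    does-⇔ (mk⇔ (proj₁ (proj₁ agree a b)) (proj₂ (proj₁ agree a b)))
           (Γ₁._≤?_ (inj₁ a) (inj₁ b)) (Γ₂._≤?_ (inj₁ a) (inj₁ b))
  leB∘emb2 (inj₁ a) (inj₂ c) = refl
  leB∘emb2 (inj₂ c) (inj₁ b) = refl
  leB∘emb2 (inj₂ c) (inj₂ d) = refl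

  ρ∘emb2 : ∀ x → Γ♯.ρ (emb2 x) ≡ Γ₂.ρ x
  ρ∘emb2 (inj₁ a) = proj₂ agree a
  ρ∘emb2 (inj₂ c) = refl

  lower₂ : ∀ y x → Γ♯.leB y (emb2 x) ≡ true → ∃[ x′ ] emb2 x′ ≡ y
  lower₂ (inj₁ b) x _ = inj₁ b , refl
  lower₂ (inj₂ (inj₂ c)) x _ = inj₂ c , refl
  lower₂ (inj₂ (inj₁ c)) (inj₁ b) c≤b = ⊥-elim (boundary-lower₁ c b (does-true⇒ (Γ₁._≤?_ (inj₂ c) (inj₁ b)) c≤b))

  δ∘emb1 : ∀ x y → Γ♯.δ (emb1 x) (emb1 y) ≡ Γ₁.δ x y
  δ∘emb1 x y = cong₂ _∸_ (ρ∘emb1 y) (ρ∘emb1 x)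

  δ∘emb2 : ∀ x y → Γ♯.δ (emb2 x) (emb2 y) ≡ Γ₂.δ x y
  δ∘emb2 x y = cong₂ _∸_ (ρ∘emb2 y) (ρ∘emb2 x)

  gI∘emb1 : ∀ {a b} → a Γ₁.≤ b → Γ♯.gI (emb1 a) (emb1 b) ≈ Γ₁.gI a b
  gI∘emb1 = gI-embedding Γ1 (Agg Γ1 Γ2) finite₁ Γ♯-finite partialOrder₁ ranked₁ emb1 emb1-injective leB∘emb1 ρ∘emb1 lower₁

  gI∘emb2 : ∀ {a b} → a Γ₂.≤ b → Γ♯.gI (emb2 a) (emb2 b) ≈ Γ₂.gI a b
  gI∘emb2 = gI-embedding Γ2 (Agg Γ1 Γ2) finite₂ Γ♯-finite partialOrder₂ ranked₂ emb2 emb2-injective leB∘emb2 ρ∘emb2 lower₂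

  ΣL-Γ♯ : ∀ (P : CB ⊎ (C1 ⊎ C2) → Bool) (F : CB ⊎ (C1 ⊎ C2) → Poly) →
          ΣL P Γ♯.enum F ≈ ΣL (P ∘ emb1) Γ₁.enum (F ∘ emb1) ⊕ ΣL (λ y → isPlus y ∧ P (emb2 y)) Γ₂.enum (F ∘ emb2)
  ΣL-Γ♯ P F k = trans (ΣL-++ P (map emb1 Γ₁.enum) (mapMaybe int2 Γ₂.enum) F k)
    (cong₂ (λ p q → p k + q k) (ΣL-map P emb1 Γ₁.enum F) (ΣL-mapMaybe-int2 P Γ₂.enum F))

module _ {X : Set} where

  maxL-cong-filter : ∀ {P Q : X → Bool} l (f : X → ℕ) → (∀ x → P x ≡ Q x) → maxL P l f ≡ maxL Q l f
  maxL-cong-filter [] f P≗Q = refl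
  maxL-cong-filter {P} {Q} (x ∷ l) f P≗Q rewrite P≗Q x | maxL-cong-filter {P} {Q} l f P≗Q = refl

maxL-reindex : ∀ {X Y : Set} (h : X → Y) (P : X → Bool) (P′ : Y → Bool) (f : X → ℕ) (f′ : Y → ℕ)
  (es : List X) (es′ : List Y) → (∀ x → x ∈ es) → (∀ y → y ∈ es′) →
  (∀ x → P′ (h x) ≡ P x) → (∀ y → P′ y ≡ true → ∃[ x ] h x ≡ y) → (∀ x → P x ≡ true → f′ (h x) ≡ f x) →
  maxL P′ es′ f′ ≡ maxL P es f
maxL-reindex h P P′ f f′ es es′ ∈es ∈es′ P′∘h≗P P′⊆im f′∘h≗f =
  ℕ.≤-antisym (maxL-lub P′ es′ f′ _ image-bounded) (maxL-lub P es f _ preimage-bounded)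
  where
  image-bounded : ∀ y → y ∈ es′ → P′ y ≡ true → f′ y ℕ.≤ maxL P es f
  image-bounded y _ P′y with P′⊆im y P′y
  ... | x , refl = subst (ℕ._≤ maxL P es f) (sym (f′∘h≗f x Px)) (maxL-ub P es f x (∈es x) Px)
    where
    Px : P x ≡ true
    Px = trans (sym (P′∘h≗P x)) P′y
  preimage-bounded : ∀ x → x ∈ es → P x ≡ true → f x ℕ.≤ maxL P′ es′ f′
  preimage-bounded x _ Px =
    subst (ℕ._≤ maxL P′ es′ f′) (f′∘h≗f x Px) (maxL-ub P′ es′ f′ (h x) (∈es′ (h x)) (trans (P′∘h≗P x) Px))

module _ {X : Set} (Γ : FinPoset X) where
  open FinPoset Γ

  hTerm : X → ℕ → X → Poly
  hTerm z m y = gI z y ⊛ powP tm1P (m ∸ δ z y)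

  hTerm-suc : ∀ z m y → δ z y ℕ.≤ m → hTerm z (suc m) y ≈ tm1P ⊛ hTerm z m y
  hTerm-suc z m y δ≤m rewrite ℕ.+-∸-assoc 1 δ≤m = ⊛-tm1P-comm (gI z y) (powP tm1P (m ∸ δ z y))

  Deg≤-hTerm : ∀ z m y → δ z y ℕ.≤ m → Deg≤ (hTerm z m y) m
  Deg≤-hTerm z m y δ≤m = subst (Deg≤ (hTerm z m y)) (ℕ.m+[n∸m]≡n δ≤m)
    (Deg≤-⊛ (GRecursion.Deg≤-g enum _≟_ leB δ (length enum) z y) (Deg≤-powP-tm1P (m ∸ δ z y)))

  hPoly-cong-filter : ∀ {P Q : X → Bool} z → (∀ y → P y ≡ Q y) → hPoly P z ≡ hPoly Q z
  hPoly-cong-filter {P} {Q} z P≗Q rewrite maxL-cong-filter {P = P} {Q} enum (δ z) P≗Q =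
    cong (revP _) (ΣL-cong-filter enum _ P≗Q)

  hPoly-of-rank : ∀ (P : X → Bool) z m → rankOf P z ≡ m → hPoly P z ≡ revP m (ΣL P enum (hTerm z m))
  hPoly-of-rank P z m refl = refl

rankOf-fibre : ∀ {D E : Set} (Γ : FinPoset D) (S : D → Bool) (B : FinPoset E) (σ : D → E) →
  (∀ y → y ∈ FinPoset.enum Γ) → IsSFS Γ S B σ →
  (∀ x → FinPoset._≤_ B x x) → (∀ {u v} → FinPoset._≤_ B u v → FinPoset.ρ B u ℕ.≤ FinPoset.ρ B v) →
  ∀ z → T (S z) → FinPoset.ρ Γ z ≡ 0 → ∀ x → FinPoset._≤_ B (σ z) x →
  FinPoset.rankOf Γ (λ y → S y ∧ FinPoset.leB B (σ y) x) z ≡ FinPoset.ρ B x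
rankOf-fibre Γ S B σ ∈Γ sfs B-refl B-mono z Sz ρz≡0 x σz≤x with IsSFS.lifting sfs z x Sz σz≤x
... | y′ , Sy′ , _ , refl , ρy′≡ρσy′ =
  maxL-≡ _ Γ.enum (Γ.δ z) (B.ρ (σ y′)) bounded y′ (∈Γ y′)
    (cong₂ _∧_ (T⇒≡true Sy′) (dec-true (σ y′ B.≤? σ y′) (B-refl _)))
    (trans (cong (Γ.ρ y′ ∸_) ρz≡0) ρy′≡ρσy′)
  where
  module Γ = FinPoset Γ
  module B = FinPoset B
  bounded : ∀ y → y ∈ Γ.enum → (S y ∧ B.leB (σ y) (σ y′)) ≡ true → Γ.δ z y ℕ.≤ B.ρ (σ y′)
  bounded y _ y∈ = ℕ.≤-trans (ℕ.m∸n≤m (Γ.ρ y) (Γ.ρ z))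
    (ℕ.≤-trans (IsSFS.rankIncreasing sfs y (≡true⇒T (∧-conicalˡ _ _ y∈)))
               (B-mono (does-true⇒ (σ y B.≤? σ y′) (∧-conicalʳ (S y) _ y∈))))

module Reindex {X Y : Set} (P : FinPoset X) (Q : FinPoset Y) (P-finite : IsFinite P) (Q-finite : IsFinite Q)
  (h : X → Y) (h-inj : ∀ {x y} → h x ≡ h y → x ≡ y)
  (F : X → Bool) (F′ : Y → Bool) (F′∘h : ∀ x → F′ (h x) ≡ F x) (F′⊆im : ∀ y → F′ y ≡ true → ∃[ x ] h x ≡ y)
  (z : X) (δ∘h : ∀ x → F x ≡ true → FinPoset.δ Q (h z) (h x) ≡ FinPoset.δ P z x)
  (gI∘h : ∀ x → F x ≡ true → FinPoset.gI Q (h z) (h x) ≈ FinPoset.gI P z x) where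

  private
    module P = FinPoset P
    module Q = FinPoset Q

  rankOf-reindex : Q.rankOf F′ (h z) ≡ P.rankOf F z
  rankOf-reindex = maxL-reindex h F F′ (P.δ z) (Q.δ (h z)) P.enum Q.enum (proj₁ P-finite) (proj₁ Q-finite) F′∘h F′⊆im δ∘h

  hPoly-reindex : Q.hPoly F′ (h z) ≈ P.hPoly F z
  hPoly-reindex = begin
    Q.hPoly F′ (h z)                          ≡⟨ hPoly-of-rank Q F′ (h z) m rankOf-reindex ⟩
    revP m (ΣL F′ Q.enum (hTerm Q (h z) m))
      ≈⟨ revP-cong m (ΣL-reindex h F F′ _ _ P.enum Q.enum h-inj (proj₂ P-finite) (proj₂ Q-finite)
                       (proj₁ P-finite) (proj₁ Q-finite) F′∘h F′⊆im terms) ⟩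
    revP m (ΣL F P.enum (hTerm P z m))        ≡⟨ hPoly-of-rank P F z m refl ⟨
    P.hPoly F z                               ∎
    where
    open ≈-Reasoning
    m : ℕ
    m = P.rankOf F z
    terms : ∀ x → F x ≡ true → hTerm Q (h z) m (h x) ≈ hTerm P z m x
    terms x Fx rewrite δ∘h x Fx = ⊛-congˡ (powP tm1P (m ∸ P.δ z x)) (gI∘h x Fx)


-- The argument never uses the Euler conditions (IntervalsEulerian, IsSFS.eulerSum) nor the rank
-- condition of IsPosetWithBoundary: only orders, ranks and the lifting property enter.
module AgglutinationFormula {C CB C1 C2 : Set}
    (R : FinPoset C) (bR tR : C) (finR : IsFinite R) (ER : Eulerian R bR tR)
    (Γ1 : FinPoset (CB ⊎ C1)) (Γ2 : FinPoset (CB ⊎ C2)) (z : CB)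
    (fin1 : IsFinite Γ1) (fin2 : IsFinite Γ2)
    (L1 : LowerEulerian Γ1 (inj₁ z)) (L2 : LowerEulerian Γ2 (inj₁ z))
    (PB1 : IsPosetWithBoundary Γ1) (PB2 : IsPosetWithBoundary Γ2)
    (AG : AgreeOnBoundary Γ1 Γ2)
    (σ1 : CB ⊎ C1 → C ⊎ C) (σ2 : CB ⊎ C2 → C ⊎ C)
    (MB1 : MapsBoundary σ1) (MB2 : MapsBoundary σ2)
    (σ1≡σ2 : ∀ b → σ1 (inj₁ b) ≡ σ2 (inj₁ b))
    (S1 : IsSFS Γ1 allP (Twins R) σ1) (S2 : IsSFS Γ2 allP (Twins R) σ2)
    (SB : IsSFS Γ1 isMinus R (φ⁺ ∘ σ1)) where

  module R′ = FinPoset R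
  module R± = FinPoset (Twins R)

  R-partialOrder : IsPartialOrder _≡_ R′._≤_
  R-partialOrder = proj₁ (proj₁ (proj₁ ER))

  R-ranked : R′.Ranked
  R-ranked = proj₁ (proj₂ (proj₁ (proj₁ ER)))

  R-bottom : ∀ r → bR R′.≤ r
  R-bottom = proj₁ (proj₂ (proj₁ ER))

  R-top : ∀ r → r R′.≤ tR
  R-top = proj₂ ER

  open FiniteRankedPoset R finR R-partialOrder R-ranked using (ρ-mono; ≤⇒leB)
  open IsPartialOrder R-partialOrder using (antisym) renaming (refl to R-refl)
  open TwinsDual R finR R-partialOrder R-ranked using (ΣR; signedGDual; ℓ-over-twins; R±-refl; R±-ρ-mono)
  open Agglutination Γ1 Γ2 fin1 fin2 (proj₁ (proj₁ L1)) (proj₁ (proj₂ (proj₁ L1)))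
                     (proj₁ (proj₁ L2)) (proj₁ (proj₂ (proj₁ L2))) (proj₁ PB1) (proj₁ PB2) AG

  σ1-0̂ : σ1 (inj₁ z) ≡ inj₁ bR
  σ1-0̂ with σ1 (inj₁ z) in σ1z | proj₁ MB1 z | IsSFS.surjective S1 (inj₁ bR)
  ... | inj₁ w | _ | y , _ , σ1y≡bR = cong inj₁ (antisym w≤bR (R-bottom w))
    where
    w≤bR : w R′.≤ bR
    w≤bR = subst₂ R±._≤_ σ1z σ1y≡bR (IsSFS.orderPreserving S1 (inj₁ z) y _ _ (proj₁ (proj₂ L1) y))

  σ2-0̂ : σ2 (inj₁ z) ≡ inj₁ bR
  σ2-0̂ = trans (sym (σ1≡σ2 z)) σ1-0̂

  aggMap∘emb1 : ∀ y → aggMap σ1 σ2 (emb1 y) ≡ φ⁺ (σ1 y)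
  aggMap∘emb1 (inj₁ b) = refl
  aggMap∘emb1 (inj₂ c) = refl

  aggMap∘emb2 : ∀ y → aggMap σ1 σ2 (emb2 y) ≡ φ⁺ (σ2 y)
  aggMap∘emb2 (inj₁ b) = cong φ⁺ (σ1≡σ2 b)
  aggMap∘emb2 (inj₂ c) = refl

  -- the subposets Γ¹_r, Γ¹_{r⁻}, (Γ_B)_r, Γ²_r, Γ²_{r⁻}, (Γ¹♯Γ²)_r and its boundary part
  over⁺₁ over⁻₁ over∂ : C → CB ⊎ C1 → Bool
  over⁺₁ r y = R±.leB (σ1 y) (inj₂ r)
  over⁻₁ r y = R±.leB (σ1 y) (inj₁ r)
  over∂ r y = isMinus y ∧ R′.leB (φ⁺ (σ1 y)) r

  over⁺₂ over⁻₂ : C → CB ⊎ C2 → Bool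
  over⁺₂ r y = R±.leB (σ2 y) (inj₂ r)
  over⁻₂ r y = R±.leB (σ2 y) (inj₁ r)

  over♯ over∂♯ : C → CB ⊎ (C1 ⊎ C2) → Bool
  over♯ r y = R′.leB (aggMap σ1 σ2 y) r
  over∂♯ r y = isMinus y ∧ over♯ r y

  over⁻₁≗over∂ : ∀ r y → over⁻₁ r y ≡ over∂ r y
  over⁻₁≗over∂ r (inj₁ b) = twins-leB-minus R (σ1 (inj₁ b)) r (proj₁ MB1 b)
  over⁻₁≗over∂ r (inj₂ c) = twins-leB-plus-minus R (σ1 (inj₂ c)) r (proj₂ MB1 c)

  over∂♯∘emb1 : ∀ r y → over∂♯ r (emb1 y) ≡ over∂ r y
  over∂♯∘emb1 r (inj₁ b) = refl
  over∂♯∘emb1 r (inj₂ c) = refl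

  over∂♯∘emb2 : ∀ r y → over∂♯ r (emb2 y) ≡ over⁻₂ r y
  over∂♯∘emb2 r (inj₁ b) = sym (trans (twins-leB-minus R (σ2 (inj₁ b)) r (proj₁ MB2 b)) (cong (λ u → R′.leB (φ⁺ u) r) (sym (σ1≡σ2 b))))
  over∂♯∘emb2 r (inj₂ c) = sym (twins-leB-plus-minus R (σ2 (inj₂ c)) r (proj₂ MB2 c))

  over∂♯⊆emb1 : ∀ r y → over∂♯ r y ≡ true → ∃[ x ] emb1 x ≡ y
  over∂♯⊆emb1 r (inj₁ b) _ = inj₁ b , refl

  over∂♯⊆emb2 : ∀ r y → over∂♯ r y ≡ true → ∃[ x ] emb2 x ≡ y
  over∂♯⊆emb2 r (inj₁ b) _ = inj₁ b , refl

  over♯∘emb1 : ∀ r y → over♯ r (emb1 y) ≡ over⁺₁ r y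
  over♯∘emb1 r y = trans (cong (λ u → R′.leB u r) (aggMap∘emb1 y)) (sym (twins-leB-plus R (σ1 y) r))

  over♯∘emb2 : ∀ r y → over♯ r (emb2 y) ≡ over⁺₂ r y
  over♯∘emb2 r y = trans (cong (λ u → R′.leB u r) (aggMap∘emb2 y)) (sym (twins-leB-plus R (σ2 y) r))

  h⁺₁ h⁺₂ h⁻₂ h∂ h♯ : C → Poly
  h⁺₁ r = Γ₁.hPoly (over⁺₁ r) (inj₁ z)
  h⁺₂ r = Γ₂.hPoly (over⁺₂ r) (inj₁ z)
  h⁻₂ r = Γ₂.hPoly (over⁻₂ r) (inj₁ z)
  h∂ r = Γ₁.hPoly (over∂ r) (inj₁ z)
  h♯ r = Γ♯.hPoly (over♯ r) (inj₁ z)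

  module ∂₁ (r : C) = Reindex Γ1 (Agg Γ1 Γ2) fin1 Γ♯-finite emb1 emb1-injective (over∂ r) (over∂♯ r)
    (over∂♯∘emb1 r) (over∂♯⊆emb1 r)
    (inj₁ z) (λ y _ → δ∘emb1 (inj₁ z) y) (λ y _ → gI∘emb1 (proj₁ (proj₂ L1) y))

  module ∂₂ (r : C) = Reindex Γ2 (Agg Γ1 Γ2) fin2 Γ♯-finite emb2 emb2-injective (over⁻₂ r) (over∂♯ r)
    (over∂♯∘emb2 r) (over∂♯⊆emb2 r)
    (inj₁ z) (λ y _ → δ∘emb2 (inj₁ z) y) (λ y _ → gI∘emb2 (proj₁ (proj₂ L2) y))

  h⁻₂≈h∂ : ∀ r → h⁻₂ r ≈ h∂ r
  h⁻₂≈h∂ r = ≈-trans (≈-sym (∂₂.hPoly-reindex r)) (∂₁.hPoly-reindex r)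

  rank⁺₁ : ∀ r → Γ₁.rankOf (over⁺₁ r) (inj₁ z) ≡ suc (R′.ρ r)
  rank⁺₁ r = rankOf-fibre Γ1 allP (Twins R) σ1 (proj₁ fin1) S1 R±-refl (λ {u} {v} → R±-ρ-mono {u} {v}) (inj₁ z) _ (proj₂ (proj₂ L1))
    (inj₂ r) (subst (R±._≤ inj₂ r) (sym σ1-0̂) (R-bottom r))

  rank⁺₂ : ∀ r → Γ₂.rankOf (over⁺₂ r) (inj₁ z) ≡ suc (R′.ρ r)
  rank⁺₂ r = rankOf-fibre Γ2 allP (Twins R) σ2 (proj₁ fin2) S2 R±-refl (λ {u} {v} → R±-ρ-mono {u} {v}) (inj₁ z) _ (proj₂ (proj₂ L2))
    (inj₂ r) (subst (R±._≤ inj₂ r) (sym σ2-0̂) (R-bottom r))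

  rank∂ : ∀ r → Γ₁.rankOf (over∂ r) (inj₁ z) ≡ R′.ρ r
  rank∂ r = rankOf-fibre Γ1 isMinus R (φ⁺ ∘ σ1) (proj₁ fin1) SB (λ _ → R-refl) ρ-mono (inj₁ z) _ (proj₂ (proj₂ L1))
    r (subst (λ u → φ⁺ u R′.≤ r) (sym σ1-0̂) (R-bottom r))

  rank⁻₂ : ∀ r → Γ₂.rankOf (over⁻₂ r) (inj₁ z) ≡ R′.ρ r
  rank⁻₂ r = trans (sym (∂₂.rankOf-reindex r)) (trans (∂₁.rankOf-reindex r) (rank∂ r))

  rank♯ : ∀ r → Γ♯.rankOf (over♯ r) (inj₁ z) ≡ suc (R′.ρ r)
  rank♯ r with maxL-attained (over⁺₁ r) Γ₁.enum (Γ₁.δ (inj₁ z))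
  ... | inj₂ none = case trans (sym (none (inj₁ z) (proj₁ fin1 (inj₁ z)))) 0̂-over of λ ()
    where
    0̂-over : over⁺₁ r (inj₁ z) ≡ true
    0̂-over = trans (cong (λ u → R±.leB u (inj₂ r)) σ1-0̂) (≤⇒leB (R-bottom r))
  ... | inj₁ (w , _ , w-over , δw≡max) =
    maxL-≡ (over♯ r) Γ♯.enum (Γ♯.δ (inj₁ z)) (suc (R′.ρ r)) bounded (emb1 w) (∈Γ♯ _)
      (trans (over♯∘emb1 r w) w-over) (trans (δ∘emb1 (inj₁ z) w) (trans δw≡max (rank⁺₁ r)))
    where
    via₁ : ∀ x → over♯ r (emb1 x) ≡ true → Γ♯.δ (inj₁ z) (emb1 x) ℕ.≤ suc (R′.ρ r)
    via₁ x x-over = subst₂ ℕ._≤_ (sym (δ∘emb1 (inj₁ z) x)) (rank⁺₁ r)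
      (maxL-ub (over⁺₁ r) Γ₁.enum (Γ₁.δ (inj₁ z)) x (proj₁ fin1 x) (trans (sym (over♯∘emb1 r x)) x-over))
    via₂ : ∀ x → over♯ r (emb2 x) ≡ true → Γ♯.δ (inj₁ z) (emb2 x) ℕ.≤ suc (R′.ρ r)
    via₂ x x-over = subst₂ ℕ._≤_ (sym (δ∘emb2 (inj₁ z) x)) (rank⁺₂ r)
      (maxL-ub (over⁺₂ r) Γ₂.enum (Γ₂.δ (inj₁ z)) x (proj₁ fin2 x) (trans (sym (over♯∘emb2 r x)) x-over))
    bounded : ∀ y → y ∈ Γ♯.enum → over♯ r y ≡ true → Γ♯.δ (inj₁ z) y ℕ.≤ suc (R′.ρ r)
    bounded (inj₁ b) _ = via₁ (inj₁ b)
    bounded (inj₂ (inj₁ c)) _ = via₁ (inj₂ c)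
    bounded (inj₂ (inj₂ c)) _ = via₂ (inj₂ c)

  over⁺₂∖interior≗over⁻₂ : ∀ r y → (over⁺₂ r y ∧ not (isPlus y)) ≡ over⁻₂ r y
  over⁺₂∖interior≗over⁻₂ r (inj₁ b) = trans (∧-identityʳ _)
    (trans (twins-leB-plus R (σ2 (inj₁ b)) r) (sym (twins-leB-minus R (σ2 (inj₁ b)) r (proj₁ MB2 b))))
  over⁺₂∖interior≗over⁻₂ r (inj₂ c) = trans (∧-zeroʳ _) (sym (twins-leB-plus-minus R (σ2 (inj₂ c)) r (proj₂ MB2 c)))

  δ-bound⁻₂ : ∀ r y → over⁻₂ r y ≡ true → Γ₂.δ (inj₁ z) y ℕ.≤ R′.ρ r
  δ-bound⁻₂ r y y-over = subst (Γ₂.δ (inj₁ z) y ℕ.≤_) (rank⁻₂ r)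
    (maxL-ub (over⁻₂ r) Γ₂.enum (Γ₂.δ (inj₁ z)) y (proj₁ fin2 y) y-over)

  module Fibre (r : C) where
    m : ℕ
    m = suc (R′.ρ r)

    S♯ S⁺₁ S⁺₂ X⁻₂ : Poly
    S♯ = ΣL (over♯ r) Γ♯.enum (hTerm (Agg Γ1 Γ2) (inj₁ z) m)
    S⁺₁ = ΣL (over⁺₁ r) Γ₁.enum (hTerm Γ1 (inj₁ z) m)
    S⁺₂ = ΣL (over⁺₂ r) Γ₂.enum (hTerm Γ2 (inj₁ z) m)
    X⁻₂ = ΣL (over⁻₂ r) Γ₂.enum (hTerm Γ2 (inj₁ z) (R′.ρ r))

    interior₂ : ΣL (λ y → over⁺₂ r y ∧ isPlus y) Γ₂.enum (hTerm Γ2 (inj₁ z) m) ≈ S⁺₂ ⊕ negP (tm1P ⊛ X⁻₂)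
    interior₂ = ⊕-transpose (begin
      S⁺₂ ≈⟨ ΣL-split (over⁺₂ r) isPlus Γ₂.enum _ ⟩
      ΣL (λ y → over⁺₂ r y ∧ isPlus y) Γ₂.enum (hTerm Γ2 (inj₁ z) m)
        ⊕ ΣL (λ y → over⁺₂ r y ∧ not (isPlus y)) Γ₂.enum (hTerm Γ2 (inj₁ z) m)
        ≈⟨ ⊕-congʳ (ΣL (λ y → over⁺₂ r y ∧ isPlus y) Γ₂.enum (hTerm Γ2 (inj₁ z) m)) boundary₂ ⟩
      ΣL (λ y → over⁺₂ r y ∧ isPlus y) Γ₂.enum (hTerm Γ2 (inj₁ z) m) ⊕ tm1P ⊛ X⁻₂ ∎)
      where
      open ≈-Reasoning
      boundary₂ : ΣL (λ y → over⁺₂ r y ∧ not (isPlus y)) Γ₂.enum (hTerm Γ2 (inj₁ z) m) ≈ tm1P ⊛ X⁻₂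
      boundary₂ = begin
        ΣL (λ y → over⁺₂ r y ∧ not (isPlus y)) Γ₂.enum (hTerm Γ2 (inj₁ z) m)
          ≡⟨ ΣL-cong-filter Γ₂.enum _ (over⁺₂∖interior≗over⁻₂ r) ⟩
        ΣL (over⁻₂ r) Γ₂.enum (hTerm Γ2 (inj₁ z) m)
          ≈⟨ ΣL-cong (over⁻₂ r) Γ₂.enum (λ y y-over → hTerm-suc Γ2 (inj₁ z) (R′.ρ r) y (δ-bound⁻₂ r y y-over)) ⟩
        ΣL (over⁻₂ r) Γ₂.enum (λ y → tm1P ⊛ hTerm Γ2 (inj₁ z) (R′.ρ r) y)
          ≈⟨ ⊛-distribˡ-ΣL tm1P (over⁻₂ r) Γ₂.enum _ ⟨
        tm1P ⊛ X⁻₂ ∎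

    S♯-decomposition : S♯ ≈ S⁺₁ ⊕ (S⁺₂ ⊕ negP (tm1P ⊛ X⁻₂))
    S♯-decomposition = begin
      S♯  ≈⟨ ΣL-Γ♯ (over♯ r) (hTerm (Agg Γ1 Γ2) (inj₁ z) m) ⟩
      ΣL (over♯ r ∘ emb1) Γ₁.enum (hTerm (Agg Γ1 Γ2) (inj₁ z) m ∘ emb1)
        ⊕ ΣL (λ y → isPlus y ∧ over♯ r (emb2 y)) Γ₂.enum (hTerm (Agg Γ1 Γ2) (inj₁ z) m ∘ emb2)
        ≡⟨ cong₂ _⊕_ (ΣL-cong-filter Γ₁.enum _ (over♯∘emb1 r))
                     (ΣL-cong-filter Γ₂.enum _ (λ y → trans (cong (isPlus y ∧_) (over♯∘emb2 r y)) (∧-comm (isPlus y) _))) ⟩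
      ΣL (over⁺₁ r) Γ₁.enum (hTerm (Agg Γ1 Γ2) (inj₁ z) m ∘ emb1)
        ⊕ ΣL (λ y → over⁺₂ r y ∧ isPlus y) Γ₂.enum (hTerm (Agg Γ1 Γ2) (inj₁ z) m ∘ emb2)
        ≈⟨ ⊕-cong (ΣL-cong (over⁺₁ r) Γ₁.enum (λ y _ → term₁ y))
                  (ΣL-cong (λ y → over⁺₂ r y ∧ isPlus y) Γ₂.enum (λ y _ → term₂ y)) ⟩
      S⁺₁ ⊕ ΣL (λ y → over⁺₂ r y ∧ isPlus y) Γ₂.enum (hTerm Γ2 (inj₁ z) m)
        ≈⟨ ⊕-congʳ S⁺₁ interior₂ ⟩
      S⁺₁ ⊕ (S⁺₂ ⊕ negP (tm1P ⊛ X⁻₂)) ∎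
      where
      open ≈-Reasoning
      term₁ : ∀ y → hTerm (Agg Γ1 Γ2) (inj₁ z) m (emb1 y) ≈ hTerm Γ1 (inj₁ z) m y
      term₁ y rewrite δ∘emb1 (inj₁ z) y = ⊛-congˡ (powP tm1P (m ∸ Γ₁.δ (inj₁ z) y)) (gI∘emb1 (proj₁ (proj₂ L1) y))
      term₂ : ∀ y → hTerm (Agg Γ1 Γ2) (inj₁ z) m (emb2 y) ≈ hTerm Γ2 (inj₁ z) m y
      term₂ y rewrite δ∘emb2 (inj₁ z) y = ⊛-congˡ (powP tm1P (m ∸ Γ₂.δ (inj₁ z) y)) (gI∘emb2 (proj₁ (proj₂ L2) y))

    h♯-decomposition : h♯ r ≈ h⁺₁ r ⊕ (h⁺₂ r ⊕ tm1P ⊛ h∂ r)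
    h♯-decomposition = begin
      h♯ r
        ≡⟨ hPoly-of-rank (Agg Γ1 Γ2) (over♯ r) (inj₁ z) m (rank♯ r) ⟩
      revP m S♯
        ≈⟨ revP-cong m S♯-decomposition ⟩
      revP m (S⁺₁ ⊕ (S⁺₂ ⊕ negP (tm1P ⊛ X⁻₂)))
        ≈⟨ ≈-trans (revP-⊕ m S⁺₁ (S⁺₂ ⊕ negP (tm1P ⊛ X⁻₂)))
                  (⊕-congʳ (revP m S⁺₁) (≈-trans (revP-⊕ m S⁺₂ (negP (tm1P ⊛ X⁻₂))) (⊕-congʳ (revP m S⁺₂) (revP-negP m (tm1P ⊛ X⁻₂))))) ⟩
      revP m S⁺₁ ⊕ (revP m S⁺₂ ⊕ negP (revP m (tm1P ⊛ X⁻₂)))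
        ≈⟨ ⊕-congʳ (revP m S⁺₁) (⊕-congʳ (revP m S⁺₂) (negP-cong (revP-tm1P-⊛ (R′.ρ r) X⁻₂ X⁻₂≤ρr))) ⟩
      revP m S⁺₁ ⊕ (revP m S⁺₂ ⊕ negP (revP (R′.ρ r) X⁻₂ ⊕ negP (shift (revP (R′.ρ r) X⁻₂))))
        ≡⟨ cong₂ _⊕_ (hPoly-of-rank Γ1 (over⁺₁ r) (inj₁ z) m (rank⁺₁ r))
                     (cong₂ (λ q w → q ⊕ negP (w ⊕ negP (shift w)))
                            (hPoly-of-rank Γ2 (over⁺₂ r) (inj₁ z) m (rank⁺₂ r))
                            (hPoly-of-rank Γ2 (over⁻₂ r) (inj₁ z) (R′.ρ r) (rank⁻₂ r))) ⟨
      h⁺₁ r ⊕ (h⁺₂ r ⊕ negP (h⁻₂ r ⊕ negP (shift (h⁻₂ r))))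
        ≈⟨ ⊕-congʳ (h⁺₁ r) (⊕-congʳ (h⁺₂ r) (λ k → trans (negate-difference (h⁻₂ r k) (shift (h⁻₂ r) k)) (sym (tm1P-⊛ (h⁻₂ r) k)))) ⟩
      h⁺₁ r ⊕ (h⁺₂ r ⊕ tm1P ⊛ h⁻₂ r)
        ≈⟨ ⊕-congʳ (h⁺₁ r) (⊕-congʳ (h⁺₂ r) (⊛-congʳ tm1P (h⁻₂≈h∂ r))) ⟩
      h⁺₁ r ⊕ (h⁺₂ r ⊕ tm1P ⊛ h∂ r) ∎
      where
      open ≈-Reasoning
      X⁻₂≤ρr : Deg≤ X⁻₂ (R′.ρ r)
      X⁻₂≤ρr = Deg≤-ΣL (over⁻₂ r) Γ₂.enum _ (R′.ρ r)
        (λ y y-over → Deg≤-hTerm Γ2 (inj₁ z) (R′.ρ r) y (δ-bound⁻₂ r y y-over))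
      negate-difference : ∀ a b → - (a + - b) ≡ b + - a
      negate-difference = solve-∀

  Y : C → Poly
  Y = signedGDual tR

  U V W : Poly
  U = ΣR (λ r → h⁺₁ r ⊛ Y r)
  V = ΣR (λ r → h⁺₂ r ⊛ Y r)
  W = ΣR (λ r → h∂ r ⊛ Y r)

  ℓ-twins₁ : ℓ Γ1 allP (inj₁ z) (Twins R) (inj₂ tR) σ1 ≈ negP W ⊕ U
  ℓ-twins₁ = ≈-trans (ℓ-over-twins Γ1 (inj₁ z) σ1 tR R-top) (⊕-cong (negP-cong (ΣL-cong _ R′.enum minus-term)) (≈-refl {U}))
    where
    minus-term : ∀ r → true ≡ true → Γ₁.hPoly (over⁻₁ r) (inj₁ z) ⊛ Y r ≈ h∂ r ⊛ Y r
    minus-term r _ = ⊛-congˡ (Y r) (≈-reflexive (hPoly-cong-filter Γ1 (inj₁ z) (over⁻₁≗over∂ r)))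

  ℓ-twins₂ : ℓ Γ2 allP (inj₁ z) (Twins R) (inj₂ tR) σ2 ≈ negP W ⊕ V
  ℓ-twins₂ = ≈-trans (ℓ-over-twins Γ2 (inj₁ z) σ2 tR R-top) (⊕-cong (negP-cong (ΣL-cong _ R′.enum minus-term)) (≈-refl {V}))
    where
    minus-term : ∀ r → true ≡ true → h⁻₂ r ⊛ Y r ≈ h∂ r ⊛ Y r
    minus-term r _ = ⊛-congˡ (Y r) (h⁻₂≈h∂ r)

  ℓ-agglutination : ℓ (Agg Γ1 Γ2) allP (inj₁ z) R tR (aggMap σ1 σ2) ≈ U ⊕ (V ⊕ tm1P ⊛ W)
  ℓ-agglutination = begin
    ΣR (λ r → h♯ r ⊛ Y r)
      ≈⟨ ΣL-cong _ R′.enum (λ r _ → term r) ⟩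
    ΣR (λ r → h⁺₁ r ⊛ Y r ⊕ (h⁺₂ r ⊛ Y r ⊕ tm1P ⊛ (h∂ r ⊛ Y r)))
      ≈⟨ ≈-trans (ΣL-distrib-⊕ _ R′.enum _ _) (⊕-congʳ U (ΣL-distrib-⊕ _ R′.enum _ _)) ⟩
    U ⊕ (V ⊕ ΣR (λ r → tm1P ⊛ (h∂ r ⊛ Y r)))
      ≈⟨ ⊕-congʳ U (⊕-congʳ V (⊛-distribˡ-ΣL tm1P _ R′.enum _)) ⟨
    U ⊕ (V ⊕ tm1P ⊛ W) ∎
    where
    open ≈-Reasoning
    term : ∀ r → h♯ r ⊛ Y r ≈ h⁺₁ r ⊛ Y r ⊕ (h⁺₂ r ⊛ Y r ⊕ tm1P ⊛ (h∂ r ⊛ Y r))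
    term r = begin
      h♯ r ⊛ Y r                                          ≈⟨ ⊛-congˡ (Y r) (Fibre.h♯-decomposition r) ⟩
      (h⁺₁ r ⊕ (h⁺₂ r ⊕ tm1P ⊛ h∂ r)) ⊛ Y r               ≈⟨ ⊛-distribʳ-⊕ (h⁺₁ r) _ (Y r) ⟩
      h⁺₁ r ⊛ Y r ⊕ (h⁺₂ r ⊕ tm1P ⊛ h∂ r) ⊛ Y r           ≈⟨ ⊕-congʳ (h⁺₁ r ⊛ Y r) (⊛-distribʳ-⊕ (h⁺₂ r) _ (Y r)) ⟩
      h⁺₁ r ⊛ Y r ⊕ (h⁺₂ r ⊛ Y r ⊕ (tm1P ⊛ h∂ r) ⊛ Y r)   ≈⟨ ⊕-congʳ (h⁺₁ r ⊛ Y r) (⊕-congʳ (h⁺₂ r ⊛ Y r) (tm1P-⊛-assoc (h∂ r) (Y r))) ⟩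
      h⁺₁ r ⊛ Y r ⊕ (h⁺₂ r ⊛ Y r ⊕ tm1P ⊛ (h∂ r ⊛ Y r))   ∎

lemma3p8 : {C CB C1 C2 : Set}
    (R : FinPoset C) (bR tR : C) → IsFinite R → Eulerian R bR tR →
    (Γ1 : FinPoset (CB ⊎ C1)) (Γ2 : FinPoset (CB ⊎ C2)) (z : CB) →
    IsFinite Γ1 → IsFinite Γ2 →
    LowerEulerian Γ1 (inj₁ z) → LowerEulerian Γ2 (inj₁ z) →
    IsPosetWithBoundary Γ1 → IsPosetWithBoundary Γ2 →
    AgreeOnBoundary Γ1 Γ2 →
    (σ1 : CB ⊎ C1 → C ⊎ C) (σ2 : CB ⊎ C2 → C ⊎ C) →
    MapsBoundary σ1 → MapsBoundary σ2 →
    (∀ b → σ1 (inj₁ b) ≡ σ2 (inj₁ b)) →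
    IsSFS Γ1 allP (Twins R) σ1 →
    IsSFS Γ2 allP (Twins R) σ2 →
    IsSFS Γ1 isMinus R (φ⁺ ∘ σ1) →
    ∀ k → ℓ (Agg Γ1 Γ2) allP (inj₁ z) R tR (aggMap σ1 σ2) k
        ≡ (ℓ Γ1 allP (inj₁ z) (Twins R) (inj₂ tR) σ1
           ⊕ ℓ Γ2 allP (inj₁ z) (Twins R) (inj₂ tR) σ2
           ⊕ tp1P ⊛ ℓ Γ1 isMinus (inj₁ z) R tR (φ⁺ ∘ σ1)) k
lemma3p8 R bR tR finR ER Γ1 Γ2 z fin1 fin2 L1 L2 PB1 PB2 AG σ1 σ2 MB1 MB2 σ1≡σ2 S1 S2 SB = begin
  ℓ (Agg Γ1 Γ2) allP (inj₁ z) R tR (aggMap σ1 σ2)   ≈⟨ ℓ-agglutination ⟩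
  U ⊕ (V ⊕ tm1P ⊛ W)                                 ≈⟨ ⊕-congʳ U (⊕-congʳ V (tm1P-⊛ W)) ⟩
  U ⊕ (V ⊕ (shift W ⊕ negP W))                       ≈⟨ (λ k → regroup (U k) (V k) (shift W k) (W k)) ⟩
  (negP W ⊕ U) ⊕ (negP W ⊕ V) ⊕ (shift W ⊕ W)        ≈⟨ ⊕-cong (⊕-cong ℓ-twins₁ ℓ-twins₂) (tp1P-⊛ W) ⟨
  ℓ Γ1 allP (inj₁ z) (Twins R) (inj₂ tR) σ1
    ⊕ ℓ Γ2 allP (inj₁ z) (Twins R) (inj₂ tR) σ2
    ⊕ tp1P ⊛ ℓ Γ1 isMinus (inj₁ z) R tR (φ⁺ ∘ σ1)  ∎
  where
  open AgglutinationFormula R bR tR finR ER Γ1 Γ2 z fin1 fin2 L1 L2 PB1 PB2 AG σ1 σ2 MB1 MB2 σ1≡σ2 S1 S2 SB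
  open ≈-Reasoning
  regroup : ∀ u v s w → u + (v + (s + - w)) ≡ ((- w + u) + (- w + v)) + (s + w)
  regroup = solve-∀
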